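{- Let $N=2$ (so $\eta=-1$). For $a,b\in\mathbb N$, $\alpha,\beta\in\mathbb Z/2\mathbb Z$ and $|z|<1$, $$\widetilde{\mathrm{Li}}_a(\eta^\alpha z)\,\widetilde{\mathrm{Li}}_b(\eta^\beta z)=\sum_{j=1}^a\lambda^{j;2}_{a,b;\alpha-\beta}\widetilde{\mathrm{Li}}_j(\eta^\alpha z)+\sum_{j=1}^b\lambda^{j;2}_{b,a;\beta-\alpha}\widetilde{\mathrm{Li}}_j(\eta^\beta z)+\delta_{\alpha,\beta}\widetilde{\mathrm{Li}}_{a+b}(\eta^\alpha z),$$ where $$\lambda^{j;2}_{a,b;0}=(-1)^{b-1}\binom{a+b-j-1}{a-j}\frac{B_{a+b-j}}{(a+b-j)!},\qquad \lambda^{j;2}_{a,b;1}=(2^{a+b-j}-1)\lambda^{j;2}_{a,b;0}.$$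
   Context: $\widetilde{\mathrm{Li}}_s(z)=\frac{1}{(s-1)!}\sum_{m\ge1}m^{s-1}z^m$ for $|z|<1$ and $s\in\mathbb N=\{1,2,\dots\}$. Bernoulli numbers are defined by $\frac{x}{e^x-1}=\sum_{m\ge0}B_m\frac{x^m}{m!}$. $\delta$ is the Kronecker delta. -}

module Defs where

open import Data.Nat as ℕ using (ℕ; zero; suc; _∸_; _!)
open import Data.Nat.Properties using (_!≢0)
open import Data.Nat.Combinatorics using (_C_)
open import Data.Integer using (+_)
open import Data.Fin using (Fin; zero; suc; toℕ)
open import Data.Vec using (Vec; []; _∷_; _∷ʳ_; lookup; last)
open import Data.Rational using (ℚ; 0ℚ; 1ℚ; _+_; _*_; -_; _-_; _/_)

ℕ→ℚ : ℕ → ℚ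
ℕ→ℚ n = + n / 1

invFact : ℕ → ℚ
invFact n = (+ 1 / (n !)) {{n !≢0}}

sumBelow : ℕ → (ℕ → ℚ) → ℚ
sumBelow zero    f = 0ℚ
sumBelow (suc n) f = sumBelow n f + f n

sumFin : ∀ n → (Fin n → ℚ) → ℚ
sumFin zero    f = 0ℚ
sumFin (suc n) f = f zero + sumFin n (λ k → f (suc k))

negOnePow : ℕ → ℚ
negOnePow zero    = 1ℚ
negOnePow (suc n) = - negOnePow n

powℚ : ℚ → ℕ → ℚ
powℚ q zero    = 1ℚ
powℚ q (suc n) = q * powℚ q n

-- Bernoulli numbers, via x/(e^x - 1) = Σ B_m x^m / m!.
-- Write c_m = B_m / m!.  Since (e^x - 1)/x = Σ_m x^m/(m+1)!, the series
-- Σ c_m x^m is its multiplicative inverse:  Σ_{k=0}^{m} c_k/(m-k+1)! = δ_{m,0}.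
-- bernCs n = (c_0, …, c_n).
bernCs : (n : ℕ) → Vec ℚ (suc n)
bernCs zero    = 1ℚ ∷ []
bernCs (suc n) = bernCs n ∷ʳ
  (- sumFin (suc n) (λ k → lookup (bernCs n) k * invFact (suc (suc n) ∸ toℕ k)))

bernOverFact : ℕ → ℚ
bernOverFact n = last (bernCs n)

bernoulli : ℕ → ℚ
bernoulli n = ℕ→ℚ (n !) * bernOverFact n

_⊖₂_ : Fin 2 → Fin 2 → Fin 2
zero     ⊖₂ zero     = zero
zero     ⊖₂ suc zero = suc zero
suc zero ⊖₂ zero     = suc zero
suc zero ⊖₂ suc zero = zero

etaPow : Fin 2 → ℕ → ℚ
etaPow zero     m = 1ℚ
etaPow (suc zero) m = negOnePow m

δ₂ : Fin 2 → Fin 2 → ℚ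
δ₂ zero zero = 1ℚ
δ₂ zero (suc zero) = 0ℚ
δ₂ (suc zero) zero = 0ℚ
δ₂ (suc zero) (suc zero) = 1ℚ

-- Coefficient of z^m in  Li~_s(η^α z) = 1/(s-1)! Σ_{m≥1} m^{s-1} (η^α z)^m
-- (used for s ≥ 1).
liCoeff : ℕ → Fin 2 → ℕ → ℚ
liCoeff s α zero        = 0ℚ
liCoeff s α m@(suc _) = etaPow α m * ℕ→ℚ (m ℕ.^ (s ∸ 1)) * invFact (s ∸ 1)

cauchy : (ℕ → ℚ) → (ℕ → ℚ) → ℕ → ℚ
cauchy f g n = sumBelow (suc n) (λ k → f k * g (n ∸ k))

lambda0 : ℕ → ℕ → ℕ → ℚ
lambda0 j a b =
  negOnePow (b ∸ 1) * ℕ→ℚ ((a ℕ.+ b ∸ j ∸ 1) C (a ∸ j)) * bernOverFact (a ℕ.+ b ∸ j)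

lambda : ℕ → ℕ → ℕ → Fin 2 → ℚ
lambda j a b zero       = lambda0 j a b
lambda j a b (suc zero) = (ℕ→ℚ (2 ℕ.^ (a ℕ.+ b ∸ j)) - 1ℚ) * lambda0 j a b

rhsCoeff : ℕ → ℕ → Fin 2 → Fin 2 → ℕ → ℚ
rhsCoeff a b α β n =
    sumBelow a (λ i → lambda (suc i) a b (α ⊖₂ β) * liCoeff (suc i) α n)
  + sumBelow b (λ i → lambda (suc i) b a (β ⊖₂ α) * liCoeff (suc i) β n)
  + δ₂ α β * liCoeff (a ℕ.+ b) α n

-- Both sides are power series in z, compared coefficientwise. With θ = z d/dz one has
-- θ Li~_s = s Li~_{s+1}, so F(a, b) = Li~_a(η^α z) Li~_b(η^β z) satisfies
-- θ F(a, b) = a F(a + 1, b) + b F(a, b + 1), which determines F(·, b + 1) from F(·, b).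
-- The right-hand side obeys the same recurrence: after reindexing it amounts to
-- (a - j) λ^j_{a,b} + b λ^{j+1}_{a,b+1} = 0, i.e. (u + 1) C(u + b, u + 1) = b C(u + b, u).
-- So only b = 1 remains. There Li~_1(±z) = ±z/(1 ∓ z) turns the product into partial sums
-- Σ_{k ≤ m} (±1)^{m-k} k^{a-1}/(a-1)!, which telescope against the Bernoulli polynomials
-- (generating function x eᵗˣ/(eˣ - 1)), resp. against -x eᵗˣ/(eˣ + 1), whose coefficients
-- (2ᵐ - 1) Bₘ/m! enter the λ's with γ = 1. The facts needed about x/(eˣ - 1) (its parity and its
-- behaviour under x ↦ 2x) are derived in the ring ℚ[[x]] from the recursion defining the Bₘ.
-- Finally α = 1 reduces to α = 0 by z ↦ -z.

module Submission where

open import Defs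
open import Level using (0ℓ)
open import Function using (_∘_)
open import Data.Nat as ℕ using (ℕ; zero; suc; _!; _∸_; _≤_; _<_; s≤s)
import Data.Nat.Properties as ℕ
open import Data.Nat.Combinatorics using (_C_; nCn≡1; k![n∸k]!∣n!)
open import Data.Nat.Combinatorics.Specification using (nCk≡n!/k![n-k]!)
open import Data.Nat.Properties using (_!≢0; _!*_!≢0)
open import Data.Nat.DivMod using (m/n*n≡m)
import Data.Nat.Tactic.RingSolver as ℕ-Solver
open import Data.Nat.Coprimality using (1-coprimeTo) renaming (sym to coprime-sym)
open import Data.Integer as ℤ using ()
import Data.Integer.Properties as ℤ
open import Data.Rational using (ℚ; mkℚ; 0ℚ; 1ℚ; _+_; _*_; -_; _-_; _/_)
open import Data.Rational.Properties
open import Data.Product using (_,_)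
open import Data.Fin using (Fin; zero; suc; toℕ; opposite)
open import Data.Vec using (Vec; []; _∷_; _∷ʳ_; lookup)
open import Data.Vec.Properties using (last-∷ʳ)
open import Relation.Nullary.Decidable using (dec⇒maybe)
open import Relation.Binary.PropositionalEquality
import Relation.Binary.Reasoning.Setoid as SetoidReasoning
open import Tactic.RingSolver using (solve-∀)
open import Tactic.RingSolver.Core.AlmostCommutativeRing using (AlmostCommutativeRing; fromCommutativeRing)

ℚ-ring : AlmostCommutativeRing 0ℓ 0ℓ
ℚ-ring = fromCommutativeRing +-*-commutativeRing (λ x → dec⇒maybe (0ℚ ≟ x))

ℕ→ℚ≡mkℚ : ∀ n → ℕ→ℚ n ≡ mkℚ (ℤ.+ n) 0 (coprime-sym (1-coprimeTo n))
ℕ→ℚ≡mkℚ n = ↥p/↧p≡p _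

ℕ→ℚ-+ : ∀ m n → ℕ→ℚ (m ℕ.+ n) ≡ ℕ→ℚ m + ℕ→ℚ n
ℕ→ℚ-+ m n rewrite ℕ→ℚ≡mkℚ m | ℕ→ℚ≡mkℚ n =
  cong (_/ 1) (sym (cong₂ ℤ._+_ (ℤ.*-identityʳ (ℤ.+ m)) (ℤ.*-identityʳ (ℤ.+ n))))

ℕ→ℚ-* : ∀ m n → ℕ→ℚ (m ℕ.* n) ≡ ℕ→ℚ m * ℕ→ℚ n
ℕ→ℚ-* m n rewrite ℕ→ℚ≡mkℚ m | ℕ→ℚ≡mkℚ n = cong (_/ 1) (ℤ.pos-* m n)

ℕ→ℚ-^ : ∀ m k → ℕ→ℚ (m ℕ.^ k) ≡ powℚ (ℕ→ℚ m) k
ℕ→ℚ-^ m zero    = refl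
ℕ→ℚ-^ m (suc k) = trans (ℕ→ℚ-* m (m ℕ.^ k)) (cong (ℕ→ℚ m *_) (ℕ→ℚ-^ m k))

ℕ→ℚ-suc : ∀ m → ℕ→ℚ (suc m) ≡ ℕ→ℚ m + 1ℚ
ℕ→ℚ-suc m = trans (ℕ→ℚ-+ 1 m) (+-comm 1ℚ (ℕ→ℚ m))

ℕ→ℚ-suc-*-inverseʳ : ∀ m → ℕ→ℚ (suc m) * (ℤ.+ 1 / suc m) ≡ 1ℚ
ℕ→ℚ-suc-*-inverseʳ m rewrite ℕ→ℚ≡mkℚ (suc m) =
  trans (cong (p *_) (↥p/↧p≡p (mkℚ (ℤ.+ 1) m (1-coprimeTo (suc m))))) (*-inverseʳ p)
  where p = mkℚ (ℤ.+ suc m) 0 (coprime-sym (1-coprimeTo (suc m)))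

!-*-invFact : ∀ m → ℕ→ℚ (m !) * invFact m ≡ 1ℚ
!-*-invFact m with m ! | m !≢0
... | suc k | _ = ℕ→ℚ-suc-*-inverseʳ k

invFact-suc : ∀ m → ℕ→ℚ (suc m) * invFact (suc m) ≡ invFact m
invFact-suc m = begin
  n * i′                  ≡⟨ *-identityʳ (n * i′) ⟨
  n * i′ * 1ℚ             ≡⟨ cong (n * i′ *_) (sym (!-*-invFact m)) ⟩
  n * i′ * (f * i)        ≡⟨ regroup n i′ f i ⟩
  (n * f) * i′ * i        ≡⟨ cong (λ x → x * i′ * i) (sym (ℕ→ℚ-* (suc m) (m !))) ⟩
  ℕ→ℚ (suc m !) * i′ * i  ≡⟨ cong (_* i) (!-*-invFact (suc m)) ⟩
  1ℚ * i                  ≡⟨ *-identityˡ i ⟩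
  i                       ∎
  where
  open ≡-Reasoning
  n = ℕ→ℚ (suc m); f = ℕ→ℚ (m !); i = invFact m; i′ = invFact (suc m)
  regroup : ∀ a b c d → a * b * (c * d) ≡ (a * c) * b * d
  regroup = solve-∀ ℚ-ring

ℕ→ℚ-suc-*-cancelˡ : ∀ m {x y} → ℕ→ℚ (suc m) * x ≡ ℕ→ℚ (suc m) * y → x ≡ y
ℕ→ℚ-suc-*-cancelˡ m {x} {y} nx≡ny = begin
  x            ≡⟨ *-identityˡ x ⟨
  1ℚ * x       ≡⟨ cong (_* x) (sym (ℕ→ℚ-suc-*-inverseʳ m)) ⟩
  n * r * x    ≡⟨ swap n r x ⟩
  r * (n * x)  ≡⟨ cong (r *_) nx≡ny ⟩
  r * (n * y)  ≡⟨ swap n r y ⟨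
  n * r * y    ≡⟨ cong (_* y) (ℕ→ℚ-suc-*-inverseʳ m) ⟩
  1ℚ * y       ≡⟨ *-identityˡ y ⟩
  y            ∎
  where
  open ≡-Reasoning
  n = ℕ→ℚ (suc m); r = ℤ.+ 1 / suc m
  swap : ∀ a b c → a * b * c ≡ b * (a * c)
  swap = solve-∀ ℚ-ring

x-y≡z⇒x≡y+z : ∀ {x y z} → x - y ≡ z → x ≡ y + z
x-y≡z⇒x≡y+z {x} {y} refl = x≡y+[x-y] x y
  where
  x≡y+[x-y] : ∀ x y → x ≡ y + (x - y)
  x≡y+[x-y] = solve-∀ ℚ-ring

negOnePow-+ : ∀ k j → negOnePow (k ℕ.+ j) ≡ negOnePow k * negOnePow j
negOnePow-+ zero    j = sym (*-identityˡ (negOnePow j))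
negOnePow-+ (suc k) j = trans (cong -_ (negOnePow-+ k j)) (neg-distribˡ-* (negOnePow k) (negOnePow j))

negOnePow-square : ∀ k → negOnePow k * negOnePow k ≡ 1ℚ
negOnePow-square zero    = refl
negOnePow-square (suc k) = trans (neg-square (negOnePow k)) (negOnePow-square k)
  where
  neg-square : ∀ x → - x * - x ≡ x * x
  neg-square = solve-∀ ℚ-ring

negOnePow-∸ : ∀ {k n} → k ≤ n → negOnePow (n ∸ k) ≡ negOnePow n * negOnePow k
negOnePow-∸ {k} {n} k≤n = begin
  negOnePow (n ∸ k)                                   ≡⟨ *-identityˡ _ ⟨
  1ℚ * negOnePow (n ∸ k)                              ≡⟨ cong (_* negOnePow (n ∸ k)) (sym (negOnePow-square k)) ⟩
  negOnePow k * negOnePow k * negOnePow (n ∸ k)       ≡⟨ regroup (negOnePow k) (negOnePow (n ∸ k)) ⟩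
  negOnePow k * negOnePow (n ∸ k) * negOnePow k       ≡⟨ cong (_* negOnePow k) (sym (negOnePow-+ k (n ∸ k))) ⟩
  negOnePow (k ℕ.+ (n ∸ k)) * negOnePow k             ≡⟨ cong (λ i → negOnePow i * negOnePow k) (ℕ.m+[n∸m]≡n k≤n) ⟩
  negOnePow n * negOnePow k                           ∎
  where
  open ≡-Reasoning
  regroup : ∀ a b → a * a * b ≡ a * b * a
  regroup = solve-∀ ℚ-ring

powℚ-1 : ∀ m → powℚ 1ℚ m ≡ 1ℚ
powℚ-1 zero    = refl
powℚ-1 (suc m) = trans (*-identityˡ (powℚ 1ℚ m)) (powℚ-1 m)

powℚ-neg1 : ∀ m → powℚ (- 1ℚ) m ≡ negOnePow m
powℚ-neg1 zero    = refl
powℚ-neg1 (suc m) = trans (sym (neg-distribˡ-* 1ℚ (powℚ (- 1ℚ) m)))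
                          (cong -_ (trans (*-identityˡ (powℚ (- 1ℚ) m)) (powℚ-neg1 m)))

sumBelow-cong-< : ∀ n {f g : ℕ → ℚ} → (∀ k → k < n → f k ≡ g k) → sumBelow n f ≡ sumBelow n g
sumBelow-cong-< zero    f≡g = refl
sumBelow-cong-< (suc n) f≡g =
  cong₂ _+_ (sumBelow-cong-< n (λ k k<n → f≡g k (ℕ.m<n⇒m<1+n k<n))) (f≡g n (ℕ.n<1+n n))

sumBelow-cong : ∀ n {f g : ℕ → ℚ} → f ≗ g → sumBelow n f ≡ sumBelow n g
sumBelow-cong n f≗g = sumBelow-cong-< n (λ k _ → f≗g k)

sumBelow-0 : ∀ n → sumBelow n (λ _ → 0ℚ) ≡ 0ℚ
sumBelow-0 zero    = refl
sumBelow-0 (suc n) = trans (+-identityʳ _) (sumBelow-0 n)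

sumBelow-distrib-+ : ∀ n (f g : ℕ → ℚ) →
  sumBelow n (λ k → f k + g k) ≡ sumBelow n f + sumBelow n g
sumBelow-distrib-+ zero    f g = refl
sumBelow-distrib-+ (suc n) f g =
  trans (cong (_+ (f n + g n)) (sumBelow-distrib-+ n f g)) (interchange (sumBelow n f) (sumBelow n g) (f n) (g n))
  where
  interchange : ∀ a b c d → (a + b) + (c + d) ≡ (a + c) + (b + d)
  interchange = solve-∀ ℚ-ring

*-distribˡ-sumBelow : ∀ n c (f : ℕ → ℚ) → c * sumBelow n f ≡ sumBelow n (λ k → c * f k)
*-distribˡ-sumBelow zero    c f = *-zeroʳ c
*-distribˡ-sumBelow (suc n) c f =
  trans (*-distribˡ-+ c (sumBelow n f) (f n)) (cong (_+ c * f n) (*-distribˡ-sumBelow n c f))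

*-distribʳ-sumBelow : ∀ n c (f : ℕ → ℚ) → sumBelow n f * c ≡ sumBelow n (λ k → f k * c)
*-distribʳ-sumBelow n c f = trans (*-comm (sumBelow n f) c)
  (trans (*-distribˡ-sumBelow n c f) (sumBelow-cong n (λ k → *-comm c (f k))))

neg-distrib-sumBelow : ∀ n (f : ℕ → ℚ) → - sumBelow n f ≡ sumBelow n (λ k → - f k)
neg-distrib-sumBelow zero    f = refl
neg-distrib-sumBelow (suc n) f =
  trans (neg-distrib-+ (sumBelow n f) (f n)) (cong (_+ - f n) (neg-distrib-sumBelow n f))

sumBelow-suc : ∀ n (f : ℕ → ℚ) → sumBelow (suc n) f ≡ f 0 + sumBelow n (f ∘ suc)
sumBelow-suc zero    f = trans (+-identityˡ (f 0)) (sym (+-identityʳ (f 0)))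
sumBelow-suc (suc n) f =
  trans (cong (_+ f (suc n)) (sumBelow-suc n f)) (+-assoc (f 0) (sumBelow n (f ∘ suc)) (f (suc n)))

sumBelow-reverse : ∀ n (f : ℕ → ℚ) → sumBelow n f ≡ sumBelow n (λ k → f (n ∸ suc k))
sumBelow-reverse zero    f = refl
sumBelow-reverse (suc n) f = begin
  sumBelow n f + f n                                   ≡⟨ +-comm (sumBelow n f) (f n) ⟩
  f n + sumBelow n f                                   ≡⟨ cong (f n +_) (sumBelow-reverse n f) ⟩
  f n + sumBelow n (λ k → f (n ∸ suc k))               ≡⟨ sumBelow-suc n (λ k → f (suc n ∸ suc k)) ⟨
  sumBelow (suc n) (λ k → f (suc n ∸ suc k))           ∎
  where open ≡-Reasoning

sumBelow-telescope : ∀ (F : ℕ → ℚ) n → sumBelow n (λ k → F (suc k) - F k) ≡ F n - F 0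
sumBelow-telescope F zero    = sym (+-inverseʳ (F 0))
sumBelow-telescope F (suc n) =
  trans (cong (_+ (F (suc n) - F n)) (sumBelow-telescope F n)) (collapse (F 0) (F n) (F (suc n)))
  where
  collapse : ∀ a b c → (b - a) + (c - b) ≡ c - a
  collapse = solve-∀ ℚ-ring

sumBelow-alternating-telescope : ∀ (F : ℕ → ℚ) n →
  sumBelow n (λ k → negOnePow k * (F (suc k) + F k)) ≡ F 0 + negOnePow (suc n) * F n
sumBelow-alternating-telescope F zero    = sym (collapse (F 0))
  where
  collapse : ∀ a → a + (- 1ℚ) * a ≡ 0ℚ
  collapse = solve-∀ ℚ-ring
sumBelow-alternating-telescope F (suc n) =
  trans (cong (_+ negOnePow n * (F (suc n) + F n)) (sumBelow-alternating-telescope F n))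
        (collapse (F 0) (negOnePow n) (F n) (F (suc n)))
  where
  collapse : ∀ a e b c → (a + (- e) * b) + e * (c + b) ≡ a + (- (- e)) * c
  collapse = solve-∀ ℚ-ring

sumBelow-triangle : ∀ N (H : ℕ → ℕ → ℚ) →
  sumBelow N (λ i → sumBelow (suc i) (λ k → H k i)) ≡
  sumBelow N (λ k → sumBelow (N ∸ k) (λ j → H k (k ℕ.+ j)))
sumBelow-triangle zero    H = refl
sumBelow-triangle (suc N) H = begin
  sumBelow N (λ i → sumBelow (suc i) (λ k → H k i)) + (sumBelow N (λ k → H k N) + H N N)
    ≡⟨ cong (_+ (sumBelow N (λ k → H k N) + H N N)) (sumBelow-triangle N H) ⟩
  sumBelow N rows + (sumBelow N (λ k → H k N) + H N N)
    ≡⟨ +-assoc (sumBelow N rows) _ (H N N) ⟨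
  (sumBelow N rows + sumBelow N (λ k → H k N)) + H N N
    ≡⟨ cong₂ _+_ (sym (sumBelow-distrib-+ N rows (λ k → H k N))) (sym lastRow) ⟩
  sumBelow N (λ k → rows k + H k N) + sumBelow (suc N ∸ N) (λ j → H N (N ℕ.+ j))
    ≡⟨ cong (_+ sumBelow (suc N ∸ N) (λ j → H N (N ℕ.+ j))) (sumBelow-cong-< N extendRow) ⟩
  sumBelow N (λ k → sumBelow (suc N ∸ k) (λ j → H k (k ℕ.+ j))) + sumBelow (suc N ∸ N) (λ j → H N (N ℕ.+ j))
    ∎
  where
  open ≡-Reasoning
  rows : ℕ → ℚ
  rows k = sumBelow (N ∸ k) (λ j → H k (k ℕ.+ j))
  lastRow : sumBelow (suc N ∸ N) (λ j → H N (N ℕ.+ j)) ≡ H N N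
  lastRow rewrite ℕ.m+n∸n≡m 1 N | ℕ.+-identityʳ N = +-identityˡ (H N N)
  extendRow : ∀ k → k < N → rows k + H k N ≡ sumBelow (suc N ∸ k) (λ j → H k (k ℕ.+ j))
  extendRow k k<N rewrite ℕ.+-∸-assoc 1 (ℕ.<⇒≤ k<N) | ℕ.m+[n∸m]≡n (ℕ.<⇒≤ k<N) = refl

-- Formal power series

Series : Set
Series = ℕ → ℚ

module ≗-Reasoning = SetoidReasoning (ℕ →-setoid ℚ)

infixl 7 _⋆_
infixr 7 _⊛_
infixl 6 _⊕_ _⊖_

_⋆_ : Series → Series → Series
_⋆_ = cauchy

_⊕_ : Series → Series → Series
(f ⊕ g) m = f m + g m

_⊖_ : Series → Series → Series
(f ⊖ g) m = f m - g m

_⊛_ : ℚ → Series → Series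
(c ⊛ f) m = c * f m

𝟙 : Series
𝟙 zero    = 1ℚ
𝟙 (suc _) = 0ℚ

shift : Series → Series
shift f zero    = 0ℚ
shift f (suc m) = f m

X : Series
X = shift 𝟙

θ : Series → Series
θ f m = ℕ→ℚ m * f m

twist : (ℕ → ℚ) → Series → Series
twist χ f m = χ m * f m

⊕-cong : ∀ {f f′ g g′ : Series} → f ≗ f′ → g ≗ g′ → f ⊕ g ≗ f′ ⊕ g′
⊕-cong f≗f′ g≗g′ m = cong₂ _+_ (f≗f′ m) (g≗g′ m)

⊖-cong : ∀ {f f′ g g′ : Series} → f ≗ f′ → g ≗ g′ → f ⊖ g ≗ f′ ⊖ g′
⊖-cong f≗f′ g≗g′ m = cong₂ _-_ (f≗f′ m) (g≗g′ m)

⊕-congˡ : ∀ f {g g′ : Series} → g ≗ g′ → f ⊕ g ≗ f ⊕ g′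
⊕-congˡ f = ⊕-cong {f} (λ _ → refl)

⊖-congˡ : ∀ f {g g′ : Series} → g ≗ g′ → f ⊖ g ≗ f ⊖ g′
⊖-congˡ f = ⊖-cong {f} (λ _ → refl)

⊛-congˡ : ∀ c {f g : Series} → f ≗ g → c ⊛ f ≗ c ⊛ g
⊛-congˡ c f≗g m = cong (c *_) (f≗g m)

shift-cong : ∀ {f g : Series} → f ≗ g → shift f ≗ shift g
shift-cong f≗g zero    = refl
shift-cong f≗g (suc m) = f≗g m

⋆-cong : ∀ {f f′ g g′ : Series} → f ≗ f′ → g ≗ g′ → f ⋆ g ≗ f′ ⋆ g′
⋆-cong f≗f′ g≗g′ n = sumBelow-cong (suc n) (λ k → cong₂ _*_ (f≗f′ k) (g≗g′ (n ∸ k)))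

⋆-congˡ : ∀ f {g g′ : Series} → g ≗ g′ → f ⋆ g ≗ f ⋆ g′
⋆-congˡ f = ⋆-cong {f} (λ _ → refl)

⋆-congʳ : ∀ g {f f′ : Series} → f ≗ f′ → f ⋆ g ≗ f′ ⋆ g
⋆-congʳ g f≗f′ = ⋆-cong {g = g} f≗f′ (λ _ → refl)

⋆-comm : ∀ f g → f ⋆ g ≗ g ⋆ f
⋆-comm f g n = trans (sumBelow-reverse (suc n) (λ k → f k * g (n ∸ k)))
  (sumBelow-cong-< (suc n) (λ k k≤n →
    trans (cong (λ i → f (n ∸ k) * g i) (ℕ.m∸[m∸n]≡n (ℕ.≤-pred k≤n))) (*-comm (f (n ∸ k)) (g k))))

⋆-assoc : ∀ f g h → (f ⋆ g) ⋆ h ≗ f ⋆ (g ⋆ h)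
⋆-assoc f g h n = begin
  sumBelow (suc n) (λ i → (f ⋆ g) i * h (n ∸ i))
    ≡⟨ sumBelow-cong (suc n) (λ i → *-distribʳ-sumBelow (suc i) (h (n ∸ i)) (λ k → f k * g (i ∸ k))) ⟩
  sumBelow (suc n) (λ i → sumBelow (suc i) (λ k → H k i))
    ≡⟨ sumBelow-triangle (suc n) H ⟩
  sumBelow (suc n) (λ k → sumBelow (suc n ∸ k) (λ j → H k (k ℕ.+ j)))
    ≡⟨ sumBelow-cong-< (suc n) row ⟩
  sumBelow (suc n) (λ k → f k * (g ⋆ h) (n ∸ k))
    ∎
  where
  open ≡-Reasoning
  H : ℕ → ℕ → ℚ
  H k i = f k * g (i ∸ k) * h (n ∸ i)
  row : ∀ k → k < suc n → sumBelow (suc n ∸ k) (λ j → H k (k ℕ.+ j)) ≡ f k * (g ⋆ h) (n ∸ k)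
  row k k≤n rewrite ℕ.+-∸-assoc 1 (ℕ.≤-pred k≤n) = begin
    sumBelow (suc (n ∸ k)) (λ j → f k * g (k ℕ.+ j ∸ k) * h (n ∸ (k ℕ.+ j)))
      ≡⟨ sumBelow-cong (suc (n ∸ k)) (λ j →
           trans (*-assoc (f k) _ _) (cong₂ (λ i i′ → f k * (g i * h i′)) (ℕ.m+n∸m≡n k j) (sym (ℕ.∸-+-assoc n k j)))) ⟩
    sumBelow (suc (n ∸ k)) (λ j → f k * (g j * h (n ∸ k ∸ j)))
      ≡⟨ *-distribˡ-sumBelow (suc (n ∸ k)) (f k) (λ j → g j * h (n ∸ k ∸ j)) ⟨
    f k * (g ⋆ h) (n ∸ k)
      ∎

⋆-identityʳ : ∀ f → f ⋆ 𝟙 ≗ f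
⋆-identityʳ f n = begin
  sumBelow n (λ k → f k * 𝟙 (n ∸ k)) + f n * 𝟙 (n ∸ n)
    ≡⟨ cong₂ _+_ (trans (sumBelow-cong-< n offDiagonal) (sumBelow-0 n)) diagonal ⟩
  0ℚ + f n
    ≡⟨ +-identityˡ (f n) ⟩
  f n
    ∎
  where
  open ≡-Reasoning
  offDiagonal : ∀ k → k < n → f k * 𝟙 (n ∸ k) ≡ 0ℚ
  offDiagonal k k<n rewrite ℕ.+-∸-assoc 1 k<n = *-zeroʳ (f k)
  diagonal : f n * 𝟙 (n ∸ n) ≡ f n
  diagonal rewrite ℕ.n∸n≡0 n = *-identityʳ (f n)

⋆-identityˡ : ∀ f → 𝟙 ⋆ f ≗ f
⋆-identityˡ f n = trans (⋆-comm 𝟙 f n) (⋆-identityʳ f n)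

⋆-leftComm : ∀ f g h → f ⋆ (g ⋆ h) ≗ g ⋆ (f ⋆ h)
⋆-leftComm f g h m = begin
  (f ⋆ (g ⋆ h)) m   ≡⟨ ⋆-assoc f g h m ⟨
  ((f ⋆ g) ⋆ h) m   ≡⟨ ⋆-congʳ h (⋆-comm f g) m ⟩
  ((g ⋆ f) ⋆ h) m   ≡⟨ ⋆-assoc g f h m ⟩
  (g ⋆ (f ⋆ h)) m   ∎
  where open ≡-Reasoning

⋆-distribˡ-⊕ : ∀ f g h → f ⋆ (g ⊕ h) ≗ f ⋆ g ⊕ f ⋆ h
⋆-distribˡ-⊕ f g h n =
  trans (sumBelow-cong (suc n) (λ k → *-distribˡ-+ (f k) (g (n ∸ k)) (h (n ∸ k))))
        (sumBelow-distrib-+ (suc n) _ _)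

⋆-distribʳ-⊕ : ∀ f g h → (g ⊕ h) ⋆ f ≗ g ⋆ f ⊕ h ⋆ f
⋆-distribʳ-⊕ f g h n = begin
  ((g ⊕ h) ⋆ f) n      ≡⟨ ⋆-comm (g ⊕ h) f n ⟩
  (f ⋆ (g ⊕ h)) n      ≡⟨ ⋆-distribˡ-⊕ f g h n ⟩
  (f ⋆ g ⊕ f ⋆ h) n    ≡⟨ cong₂ _+_ (⋆-comm f g n) (⋆-comm f h n) ⟩
  (g ⋆ f ⊕ h ⋆ f) n    ∎
  where open ≡-Reasoning

⋆-distribˡ-⊖ : ∀ f g h → f ⋆ (g ⊖ h) ≗ f ⋆ g ⊖ f ⋆ h
⋆-distribˡ-⊖ f g h n = begin
  sumBelow (suc n) (λ k → f k * (g (n ∸ k) - h (n ∸ k)))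
    ≡⟨ sumBelow-cong (suc n) (λ k → distrib (f k) (g (n ∸ k)) (h (n ∸ k))) ⟩
  sumBelow (suc n) (λ k → f k * g (n ∸ k) + - (f k * h (n ∸ k)))
    ≡⟨ sumBelow-distrib-+ (suc n) _ _ ⟩
  (f ⋆ g) n + sumBelow (suc n) (λ k → - (f k * h (n ∸ k)))
    ≡⟨ cong ((f ⋆ g) n +_) (sym (neg-distrib-sumBelow (suc n) (λ k → f k * h (n ∸ k)))) ⟩
  (f ⋆ g) n - (f ⋆ h) n
    ∎
  where
  open ≡-Reasoning
  distrib : ∀ a b c → a * (b - c) ≡ a * b + - (a * c)
  distrib = solve-∀ ℚ-ring

⊛-⋆-assoc : ∀ c f g → (c ⊛ f) ⋆ g ≗ c ⊛ (f ⋆ g)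
⊛-⋆-assoc c f g n =
  trans (sumBelow-cong (suc n) (λ k → *-assoc c (f k) (g (n ∸ k))))
        (sym (*-distribˡ-sumBelow (suc n) c _))

⋆-⊛-comm : ∀ c f g → f ⋆ (c ⊛ g) ≗ c ⊛ (f ⋆ g)
⋆-⊛-comm c f g n =
  trans (sumBelow-cong (suc n) (λ k → swap (f k) c (g (n ∸ k))))
        (sym (*-distribˡ-sumBelow (suc n) c _))
  where
  swap : ∀ a b c → a * (b * c) ≡ b * (a * c)
  swap = solve-∀ ℚ-ring

⋆-shiftʳ : ∀ f g → f ⋆ shift g ≗ shift (f ⋆ g)
⋆-shiftʳ f g zero    = trans (+-identityˡ (f 0 * 0ℚ)) (*-zeroʳ (f 0))
⋆-shiftʳ f g (suc m) = begin
  sumBelow (suc m) (λ k → f k * shift g (suc m ∸ k)) + f (suc m) * shift g (m ∸ m)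
    ≡⟨ cong₂ _+_ (sumBelow-cong-< (suc m) lower) top ⟩
  (f ⋆ g) m + 0ℚ
    ≡⟨ +-identityʳ ((f ⋆ g) m) ⟩
  (f ⋆ g) m
    ∎
  where
  open ≡-Reasoning
  lower : ∀ k → k < suc m → f k * shift g (suc m ∸ k) ≡ f k * g (m ∸ k)
  lower k k≤m rewrite ℕ.+-∸-assoc 1 (ℕ.≤-pred k≤m) = refl
  top : f (suc m) * shift g (m ∸ m) ≡ 0ℚ
  top rewrite ℕ.n∸n≡0 m = *-zeroʳ (f (suc m))

⋆-shiftˡ : ∀ f g → shift f ⋆ g ≗ shift (f ⋆ g)
⋆-shiftˡ f g n = begin
  (shift f ⋆ g) n      ≡⟨ ⋆-comm (shift f) g n ⟩
  (g ⋆ shift f) n      ≡⟨ ⋆-shiftʳ g f n ⟩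
  shift (g ⋆ f) n      ≡⟨ shift-cong (⋆-comm g f) n ⟩
  shift (f ⋆ g) n      ∎
  where open ≡-Reasoning

⋆-X : ∀ f → f ⋆ X ≗ shift f
⋆-X f m = trans (⋆-shiftʳ f 𝟙 m) (shift-cong (⋆-identityʳ f) m)

twist-⋆ : ∀ χ → (∀ k j → χ (k ℕ.+ j) ≡ χ k * χ j) →
          ∀ f g → twist χ (f ⋆ g) ≗ twist χ f ⋆ twist χ g
twist-⋆ χ χ-+ f g n =
  trans (*-distribˡ-sumBelow (suc n) (χ n) _) (sumBelow-cong-< (suc n) term)
  where
  interchange : ∀ a b c d → (a * b) * (c * d) ≡ (a * c) * (b * d)
  interchange = solve-∀ ℚ-ring
  term : ∀ k → k < suc n → χ n * (f k * g (n ∸ k)) ≡ χ k * f k * (χ (n ∸ k) * g (n ∸ k))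
  term k k≤n = begin
    χ n * (f k * g (n ∸ k))                    ≡⟨ cong (λ i → χ i * (f k * g (n ∸ k))) (sym (ℕ.m+[n∸m]≡n (ℕ.≤-pred k≤n))) ⟩
    χ (k ℕ.+ (n ∸ k)) * (f k * g (n ∸ k))      ≡⟨ cong (_* (f k * g (n ∸ k))) (χ-+ k (n ∸ k)) ⟩
    χ k * χ (n ∸ k) * (f k * g (n ∸ k))        ≡⟨ interchange (χ k) (χ (n ∸ k)) (f k) (g (n ∸ k)) ⟩
    χ k * f k * (χ (n ∸ k) * g (n ∸ k))        ∎
    where open ≡-Reasoning

θ-⋆ : ∀ f g → θ (f ⋆ g) ≗ θ f ⋆ g ⊕ f ⋆ θ g
θ-⋆ f g n =
  trans (*-distribˡ-sumBelow (suc n) (ℕ→ℚ n) _)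
        (trans (sumBelow-cong-< (suc n) term) (sumBelow-distrib-+ (suc n) _ _))
  where
  distrib : ∀ a b c d → (a + b) * (c * d) ≡ a * c * d + c * (b * d)
  distrib = solve-∀ ℚ-ring
  term : ∀ k → k < suc n →
         ℕ→ℚ n * (f k * g (n ∸ k)) ≡ θ f k * g (n ∸ k) + f k * θ g (n ∸ k)
  term k k≤n = begin
    ℕ→ℚ n * (f k * g (n ∸ k))                          ≡⟨ cong (λ i → ℕ→ℚ i * (f k * g (n ∸ k))) (sym (ℕ.m+[n∸m]≡n (ℕ.≤-pred k≤n))) ⟩
    ℕ→ℚ (k ℕ.+ (n ∸ k)) * (f k * g (n ∸ k))            ≡⟨ cong (_* (f k * g (n ∸ k))) (ℕ→ℚ-+ k (n ∸ k)) ⟩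
    (ℕ→ℚ k + ℕ→ℚ (n ∸ k)) * (f k * g (n ∸ k))          ≡⟨ distrib (ℕ→ℚ k) (ℕ→ℚ (n ∸ k)) (f k) (g (n ∸ k)) ⟩
    θ f k * g (n ∸ k) + f k * θ g (n ∸ k)              ∎
    where open ≡-Reasoning

θ≗⊛shift-unique : ∀ t {u v : Series} → u 0 ≡ v 0 →
                  θ u ≗ t ⊛ shift u → θ v ≗ t ⊛ shift v → u ≗ v
θ≗⊛shift-unique t u₀≡v₀ θu θv zero    = u₀≡v₀
θ≗⊛shift-unique t {u} {v} u₀≡v₀ θu θv (suc m) = ℕ→ℚ-suc-*-cancelˡ m (begin
  θ u (suc m)      ≡⟨ θu (suc m) ⟩
  t * u m          ≡⟨ cong (t *_) (θ≗⊛shift-unique t u₀≡v₀ θu θv m) ⟩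
  t * v m          ≡⟨ θv (suc m) ⟨
  θ v (suc m)      ∎)
  where open ≡-Reasoning

twist-cong : ∀ χ {f g : Series} → f ≗ g → twist χ f ≗ twist χ g
twist-cong χ f≗g m = cong (χ m *_) (f≗g m)

twist-𝟙 : ∀ χ → χ 0 ≡ 1ℚ → twist χ 𝟙 ≗ 𝟙
twist-𝟙 χ χ₀≡1 zero    = trans (*-identityʳ (χ 0)) χ₀≡1
twist-𝟙 χ χ₀≡1 (suc m) = *-zeroʳ (χ (suc m))

-- alt f and dbl f are the series f(-x) and f(2x).
alt : Series → Series
alt = twist negOnePow

alt-⋆ : ∀ f g → alt (f ⋆ g) ≗ alt f ⋆ alt g
alt-⋆ = twist-⋆ negOnePow negOnePow-+

pow2 : ℕ → ℚ
pow2 m = ℕ→ℚ (2 ℕ.^ m)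

dbl : Series → Series
dbl = twist pow2

dbl-⋆ : ∀ f g → dbl (f ⋆ g) ≗ dbl f ⋆ dbl g
dbl-⋆ = twist-⋆ pow2 (λ k j → trans (cong ℕ→ℚ (ℕ.^-distribˡ-+-* 2 k j)) (ℕ→ℚ-* (2 ℕ.^ k) (2 ℕ.^ j)))

exp : ℚ → Series
exp t m = powℚ t m * invFact m

θ-exp : ∀ t → θ (exp t) ≗ t ⊛ shift (exp t)
θ-exp t zero    = trans (*-zeroˡ (exp t 0)) (sym (*-zeroʳ t))
θ-exp t (suc m) = begin
  n * (t * p * invFact (suc m))     ≡⟨ regroup n t p (invFact (suc m)) ⟩
  t * (p * (n * invFact (suc m)))   ≡⟨ cong (λ x → t * (p * x)) (invFact-suc m) ⟩
  t * (p * invFact m)               ∎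
  where
  open ≡-Reasoning
  n = ℕ→ℚ (suc m); p = powℚ t m
  regroup : ∀ n t p i → n * (t * p * i) ≡ t * (p * (n * i))
  regroup = solve-∀ ℚ-ring

exp-+ : ∀ s t → exp s ⋆ exp t ≗ exp (s + t)
exp-+ s t = θ≗⊛shift-unique (s + t) refl θ-product (θ-exp (s + t))
  where
  open ≗-Reasoning
  θ-product : θ (exp s ⋆ exp t) ≗ (s + t) ⊛ shift (exp s ⋆ exp t)
  θ-product = begin
    θ (exp s ⋆ exp t)
      ≈⟨ θ-⋆ (exp s) (exp t) ⟩
    θ (exp s) ⋆ exp t ⊕ exp s ⋆ θ (exp t)
      ≈⟨ ⊕-cong (⋆-congʳ (exp t) (θ-exp s)) (⋆-congˡ (exp s) (θ-exp t)) ⟩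
    (s ⊛ shift (exp s)) ⋆ exp t ⊕ exp s ⋆ (t ⊛ shift (exp t))
      ≈⟨ ⊕-cong (⊛-⋆-assoc s (shift (exp s)) (exp t)) (⋆-⊛-comm t (exp s) (shift (exp t))) ⟩
    s ⊛ (shift (exp s) ⋆ exp t) ⊕ t ⊛ (exp s ⋆ shift (exp t))
      ≈⟨ ⊕-cong (⊛-congˡ s (⋆-shiftˡ (exp s) (exp t))) (⊛-congˡ t (⋆-shiftʳ (exp s) (exp t))) ⟩
    s ⊛ shift (exp s ⋆ exp t) ⊕ t ⊛ shift (exp s ⋆ exp t)
      ≈⟨ (λ m → sym (*-distribʳ-+ (shift (exp s ⋆ exp t) m) s t)) ⟩
    (s + t) ⊛ shift (exp s ⋆ exp t)
      ∎

exp-0 : exp 0ℚ ≗ 𝟙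
exp-0 zero    = refl
exp-0 (suc m) = trans (cong (_* invFact (suc m)) (*-zeroˡ (powℚ 0ℚ m))) (*-zeroˡ (invFact (suc m)))

-- The Bernoulli series x / (eˣ - 1)

expm1/x : Series
expm1/x m = invFact (suc m)

shift-expm1/x : shift expm1/x ≗ exp 1ℚ ⊖ 𝟙
shift-expm1/x zero    = refl
shift-expm1/x (suc m) = sym (begin
  powℚ 1ℚ (suc m) * invFact (suc m) - 0ℚ  ≡⟨ +-identityʳ _ ⟩
  powℚ 1ℚ (suc m) * invFact (suc m)       ≡⟨ cong (_* invFact (suc m)) (powℚ-1 (suc m)) ⟩
  1ℚ * invFact (suc m)                    ≡⟨ *-identityˡ (invFact (suc m)) ⟩
  invFact (suc m)                         ∎)
  where open ≡-Reasoning

∷ʳ-lookup-toℕ : ∀ {m} (xs : Vec ℚ m) x (g : ℕ → ℚ) → (∀ i → lookup xs i ≡ g (toℕ i)) → x ≡ g m →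
                ∀ i → lookup (xs ∷ʳ x) i ≡ g (toℕ i)
∷ʳ-lookup-toℕ []       x g xs≡g x≡g zero    = x≡g
∷ʳ-lookup-toℕ (y ∷ ys) x g xs≡g x≡g zero    = xs≡g zero
∷ʳ-lookup-toℕ (y ∷ ys) x g xs≡g x≡g (suc i) = ∷ʳ-lookup-toℕ ys x (g ∘ suc) (xs≡g ∘ suc) x≡g i

lookup-bernCs : ∀ n i → lookup (bernCs n) i ≡ bernOverFact (toℕ i)
lookup-bernCs zero    zero = refl
lookup-bernCs (suc n) i    =
  ∷ʳ-lookup-toℕ (bernCs n) _ bernOverFact (lookup-bernCs n) (sym (last-∷ʳ _ (bernCs n))) i

sumFin≡sumBelow : ∀ n {f : Fin n → ℚ} {F : ℕ → ℚ} → (∀ i → f i ≡ F (toℕ i)) → sumFin n f ≡ sumBelow n F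
sumFin≡sumBelow zero    f≡F = refl
sumFin≡sumBelow (suc n) {F = F} f≡F =
  trans (cong₂ _+_ (f≡F zero) (sumFin≡sumBelow n (f≡F ∘ suc))) (sym (sumBelow-suc n F))

bernOverFact-suc : ∀ n →
  bernOverFact (suc n) ≡ - sumBelow (suc n) (λ k → bernOverFact k * invFact (suc (suc n) ∸ k))
bernOverFact-suc n = trans (last-∷ʳ _ (bernCs n))
  (cong -_ (sumFin≡sumBelow (suc n) (λ i → cong (_* invFact (suc (suc n) ∸ toℕ i)) (lookup-bernCs n i))))

bernOverFact-⋆-expm1/x : bernOverFact ⋆ expm1/x ≗ 𝟙
bernOverFact-⋆-expm1/x zero    = refl
bernOverFact-⋆-expm1/x (suc n) = begin
  sumBelow (suc n) (λ k → c k * expm1/x (suc n ∸ k)) + c (suc n) * expm1/x (n ∸ n)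
    ≡⟨ cong₂ _+_ (sumBelow-cong-< (suc n) lower) (trans top (bernOverFact-suc n)) ⟩
  S + - S
    ≡⟨ +-inverseʳ S ⟩
  0ℚ
    ∎
  where
  open ≡-Reasoning
  c = bernOverFact
  S = sumBelow (suc n) (λ k → c k * invFact (suc (suc n) ∸ k))
  lower : ∀ k → k < suc n → c k * expm1/x (suc n ∸ k) ≡ c k * invFact (suc (suc n) ∸ k)
  lower k k≤n = cong (λ i → c k * invFact i) (sym (ℕ.+-∸-assoc 1 (ℕ.m≤n⇒m≤1+n (ℕ.≤-pred k≤n))))
  top : c (suc n) * expm1/x (n ∸ n) ≡ c (suc n)
  top rewrite ℕ.n∸n≡0 n = *-identityʳ (c (suc n))

⋆-expm1/x-cancelʳ : ∀ {u v} → u ⋆ expm1/x ≗ v ⋆ expm1/x → u ≗ v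
⋆-expm1/x-cancelʳ {u} {v} eq = begin
  u                            ≈⟨ ⋆-identityʳ u ⟨
  u ⋆ 𝟙                        ≈⟨ ⋆-congˡ u inverse ⟨
  u ⋆ (expm1/x ⋆ c)            ≈⟨ ⋆-assoc u expm1/x c ⟨
  (u ⋆ expm1/x) ⋆ c            ≈⟨ ⋆-congʳ c eq ⟩
  (v ⋆ expm1/x) ⋆ c            ≈⟨ ⋆-assoc v expm1/x c ⟩
  v ⋆ (expm1/x ⋆ c)            ≈⟨ ⋆-congˡ v inverse ⟩
  v ⋆ 𝟙                        ≈⟨ ⋆-identityʳ v ⟩
  v                            ∎
  where
  open ≗-Reasoning
  c = bernOverFact
  inverse : expm1/x ⋆ c ≗ 𝟙
  inverse m = trans (⋆-comm expm1/x c m) (bernOverFact-⋆-expm1/x m)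

shift-alt-expm1/x : shift (alt expm1/x) ≗ 𝟙 ⊖ exp (- 1ℚ)
shift-alt-expm1/x zero    = refl
shift-alt-expm1/x (suc m) = sym (begin
  0ℚ - powℚ (- 1ℚ) (suc m) * invFact (suc m)   ≡⟨ cong (λ x → 0ℚ - x * invFact (suc m)) (powℚ-neg1 (suc m)) ⟩
  0ℚ - (- negOnePow m) * invFact (suc m)       ≡⟨ simplify (negOnePow m) (invFact (suc m)) ⟩
  negOnePow m * invFact (suc m)                ∎)
  where
  open ≡-Reasoning
  simplify : ∀ e i → 0ℚ - (- e) * i ≡ e * i
  simplify = solve-∀ ℚ-ring

exp1-⋆-alt-expm1/x : exp 1ℚ ⋆ alt expm1/x ≗ expm1/x
exp1-⋆-alt-expm1/x m = shifted (suc m)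
  where
  open ≗-Reasoning
  shifted : shift (exp 1ℚ ⋆ alt expm1/x) ≗ shift expm1/x
  shifted = begin
    shift (exp 1ℚ ⋆ alt expm1/x)          ≈⟨ ⋆-shiftʳ (exp 1ℚ) (alt expm1/x) ⟨
    exp 1ℚ ⋆ shift (alt expm1/x)          ≈⟨ ⋆-congˡ (exp 1ℚ) shift-alt-expm1/x ⟩
    exp 1ℚ ⋆ (𝟙 ⊖ exp (- 1ℚ))             ≈⟨ ⋆-distribˡ-⊖ (exp 1ℚ) 𝟙 (exp (- 1ℚ)) ⟩
    exp 1ℚ ⋆ 𝟙 ⊖ exp 1ℚ ⋆ exp (- 1ℚ)      ≈⟨ ⊖-cong (⋆-identityʳ (exp 1ℚ)) (exp-+ 1ℚ (- 1ℚ)) ⟩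
    exp 1ℚ ⊖ exp (1ℚ + - 1ℚ)              ≈⟨ ⊖-congˡ (exp 1ℚ) exp-0 ⟩
    exp 1ℚ ⊖ 𝟙                            ≈⟨ shift-expm1/x ⟨
    shift expm1/x                         ∎

exp1-⋆-bernOverFact : exp 1ℚ ⋆ bernOverFact ≗ bernOverFact ⊕ X
exp1-⋆-bernOverFact m = x-y≡z⇒x≡y+z (difference m)
  where
  open ≗-Reasoning
  c = bernOverFact
  difference : exp 1ℚ ⋆ c ⊖ c ≗ X
  difference = begin
    exp 1ℚ ⋆ c ⊖ c             ≈⟨ ⊖-cong (⋆-comm (exp 1ℚ) c) (λ m → sym (⋆-identityʳ c m)) ⟩
    c ⋆ exp 1ℚ ⊖ c ⋆ 𝟙         ≈⟨ ⋆-distribˡ-⊖ c (exp 1ℚ) 𝟙 ⟨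
    c ⋆ (exp 1ℚ ⊖ 𝟙)           ≈⟨ ⋆-congˡ c shift-expm1/x ⟨
    c ⋆ shift expm1/x          ≈⟨ ⋆-shiftʳ c expm1/x ⟩
    shift (c ⋆ expm1/x)        ≈⟨ shift-cong bernOverFact-⋆-expm1/x ⟩
    X                          ∎

-- x/(eˣ - 1) + x is even: B₁ = -1/2 and the other odd Bₘ vanish.
alt-bernOverFact : alt bernOverFact ≗ bernOverFact ⊕ X
alt-bernOverFact = ⋆-expm1/x-cancelʳ (begin
  alt c ⋆ expm1/x                      ≈⟨ ⋆-congˡ (alt c) exp1-⋆-alt-expm1/x ⟨
  alt c ⋆ (exp 1ℚ ⋆ alt expm1/x)       ≈⟨ ⋆-leftComm (alt c) (exp 1ℚ) (alt expm1/x) ⟩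
  exp 1ℚ ⋆ (alt c ⋆ alt expm1/x)       ≈⟨ ⋆-congˡ (exp 1ℚ) (alt-⋆ c expm1/x) ⟨
  exp 1ℚ ⋆ alt (c ⋆ expm1/x)           ≈⟨ ⋆-congˡ (exp 1ℚ) (twist-cong negOnePow bernOverFact-⋆-expm1/x) ⟩
  exp 1ℚ ⋆ alt 𝟙                       ≈⟨ ⋆-congˡ (exp 1ℚ) (twist-𝟙 negOnePow refl) ⟩
  exp 1ℚ ⋆ 𝟙                           ≈⟨ ⋆-identityʳ (exp 1ℚ) ⟩
  exp 1ℚ                               ≈⟨ (λ m → x-y≡z⇒x≡y+z (sym (shift-expm1/x m))) ⟩
  𝟙 ⊕ shift expm1/x                    ≈⟨ ⊕-cong bernOverFact-⋆-expm1/x (shift-cong (⋆-identityˡ expm1/x)) ⟨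
  c ⋆ expm1/x ⊕ shift (𝟙 ⋆ expm1/x)    ≈⟨ ⊕-congˡ (c ⋆ expm1/x) (⋆-shiftˡ 𝟙 expm1/x) ⟨
  c ⋆ expm1/x ⊕ X ⋆ expm1/x            ≈⟨ ⋆-distribʳ-⊕ expm1/x c X ⟨
  (c ⊕ X) ⋆ expm1/x                    ∎)
  where
  open ≗-Reasoning
  c = bernOverFact

exp1⊕𝟙-⋆-expm1/x : (exp 1ℚ ⊕ 𝟙) ⋆ expm1/x ≗ dbl expm1/x ⊕ dbl expm1/x
exp1⊕𝟙-⋆-expm1/x m = begin
  ((e ⊕ 𝟙) ⋆ expm1/x) m                                     ≡⟨ ⋆-shiftʳ (e ⊕ 𝟙) expm1/x (suc m) ⟨
  ((e ⊕ 𝟙) ⋆ shift expm1/x) (suc m)                         ≡⟨ ⋆-congˡ (e ⊕ 𝟙) shift-expm1/x (suc m) ⟩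
  ((e ⊕ 𝟙) ⋆ (e ⊖ 𝟙)) (suc m)                               ≡⟨ ⋆-distribˡ-⊖ (e ⊕ 𝟙) e 𝟙 (suc m) ⟩
  ((e ⊕ 𝟙) ⋆ e) (suc m) - ((e ⊕ 𝟙) ⋆ 𝟙) (suc m)            ≡⟨ cong₂ _-_ (⋆-distribʳ-⊕ e e 𝟙 (suc m)) (⋆-identityʳ (e ⊕ 𝟙) (suc m)) ⟩
  ((e ⋆ e) (suc m) + (𝟙 ⋆ e) (suc m)) - (e (suc m) + 0ℚ)   ≡⟨ cong₂ (λ x y → (x + y) - (e (suc m) + 0ℚ)) (exp-+ 1ℚ 1ℚ (suc m)) (⋆-identityˡ e (suc m)) ⟩
  (exp 2ℚ (suc m) + e (suc m)) - (e (suc m) + 0ℚ)           ≡⟨ cancel (exp 2ℚ (suc m)) (e (suc m)) ⟩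
  2ℚ * powℚ 2ℚ m * expm1/x m                                ≡⟨ cong (λ x → 2ℚ * x * expm1/x m) (ℕ→ℚ-^ 2 m) ⟨
  2ℚ * pow2 m * expm1/x m                                   ≡⟨ double (pow2 m) (expm1/x m) ⟩
  pow2 m * expm1/x m + pow2 m * expm1/x m                   ∎
  where
  open ≡-Reasoning
  e = exp 1ℚ
  2ℚ = 1ℚ + 1ℚ
  cancel : ∀ x y → (x + y) - (y + 0ℚ) ≡ x
  cancel = solve-∀ ℚ-ring
  double : ∀ x y → (1ℚ + 1ℚ) * x * y ≡ x * y + x * y
  double = solve-∀ ℚ-ring

exp1⊕𝟙-⋆-dbl-bernOverFact : (exp 1ℚ ⊕ 𝟙) ⋆ dbl bernOverFact ≗ bernOverFact ⊕ bernOverFact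
exp1⊕𝟙-⋆-dbl-bernOverFact = ⋆-expm1/x-cancelʳ (begin
  ((e ⊕ 𝟙) ⋆ dbl c) ⋆ expm1/x                    ≈⟨ ⋆-assoc (e ⊕ 𝟙) (dbl c) expm1/x ⟩
  (e ⊕ 𝟙) ⋆ (dbl c ⋆ expm1/x)                    ≈⟨ ⋆-leftComm (e ⊕ 𝟙) (dbl c) expm1/x ⟩
  dbl c ⋆ ((e ⊕ 𝟙) ⋆ expm1/x)                    ≈⟨ ⋆-congˡ (dbl c) exp1⊕𝟙-⋆-expm1/x ⟩
  dbl c ⋆ (dbl expm1/x ⊕ dbl expm1/x)            ≈⟨ ⋆-distribˡ-⊕ (dbl c) (dbl expm1/x) (dbl expm1/x) ⟩
  dbl c ⋆ dbl expm1/x ⊕ dbl c ⋆ dbl expm1/x      ≈⟨ ⊕-cong (dbl-⋆ c expm1/x) (dbl-⋆ c expm1/x) ⟨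
  dbl (c ⋆ expm1/x) ⊕ dbl (c ⋆ expm1/x)          ≈⟨ ⊕-cong dbl-inverse dbl-inverse ⟩
  𝟙 ⊕ 𝟙                                          ≈⟨ ⊕-cong bernOverFact-⋆-expm1/x bernOverFact-⋆-expm1/x ⟨
  c ⋆ expm1/x ⊕ c ⋆ expm1/x                      ≈⟨ ⋆-distribʳ-⊕ expm1/x c c ⟨
  (c ⊕ c) ⋆ expm1/x                              ∎)
  where
  open ≗-Reasoning
  e = exp 1ℚ
  c = bernOverFact
  dbl-inverse : dbl (c ⋆ expm1/x) ≗ 𝟙
  dbl-inverse m = trans (twist-cong pow2 bernOverFact-⋆-expm1/x m) (twist-𝟙 pow2 refl m)

-- The coefficients of -x/(eˣ + 1).
twistedBern : Series
twistedBern m = (pow2 m - 1ℚ) * bernOverFact m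

exp1⊕𝟙-⋆-twistedBern : (exp 1ℚ ⊕ 𝟙) ⋆ twistedBern ≗ (- 1ℚ) ⊛ X
exp1⊕𝟙-⋆-twistedBern = begin
  (e ⊕ 𝟙) ⋆ twistedBern                    ≈⟨ ⋆-congˡ (e ⊕ 𝟙) (λ m → distrib (pow2 m) (c m)) ⟩
  (e ⊕ 𝟙) ⋆ (dbl c ⊖ c)                    ≈⟨ ⋆-distribˡ-⊖ (e ⊕ 𝟙) (dbl c) c ⟩
  (e ⊕ 𝟙) ⋆ dbl c ⊖ (e ⊕ 𝟙) ⋆ c            ≈⟨ ⊖-cong exp1⊕𝟙-⋆-dbl-bernOverFact (⋆-distribʳ-⊕ c e 𝟙) ⟩
  (c ⊕ c) ⊖ (e ⋆ c ⊕ 𝟙 ⋆ c)                ≈⟨ ⊖-congˡ (c ⊕ c) (⊕-cong exp1-⋆-bernOverFact (⋆-identityˡ c)) ⟩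
  (c ⊕ c) ⊖ ((c ⊕ X) ⊕ c)                  ≈⟨ (λ m → cancel (c m) (X m)) ⟩
  (- 1ℚ) ⊛ X                               ∎
  where
  open ≗-Reasoning
  e = exp 1ℚ
  c = bernOverFact
  distrib : ∀ p c → (p - 1ℚ) * c ≡ p * c - c
  distrib = solve-∀ ℚ-ring
  cancel : ∀ c x → (c + c) - ((c + x) + c) ≡ (- 1ℚ) * x
  cancel = solve-∀ ℚ-ring

pow2-1*X : ∀ m → (pow2 m - 1ℚ) * X m ≡ X m
pow2-1*X zero          = *-zeroʳ (pow2 0 - 1ℚ)
pow2-1*X (suc zero)    = refl
pow2-1*X (suc (suc m)) = *-zeroʳ (pow2 (suc (suc m)) - 1ℚ)

alt-twistedBern : alt twistedBern ≗ twistedBern ⊕ X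
alt-twistedBern m = begin
  negOnePow m * ((pow2 m - 1ℚ) * c m)          ≡⟨ swap (negOnePow m) (pow2 m - 1ℚ) (c m) ⟩
  (pow2 m - 1ℚ) * (negOnePow m * c m)          ≡⟨ cong ((pow2 m - 1ℚ) *_) (alt-bernOverFact m) ⟩
  (pow2 m - 1ℚ) * (c m + X m)                  ≡⟨ *-distribˡ-+ (pow2 m - 1ℚ) (c m) (X m) ⟩
  twistedBern m + (pow2 m - 1ℚ) * X m          ≡⟨ cong (twistedBern m +_) (pow2-1*X m) ⟩
  twistedBern m + X m                          ∎
  where
  open ≡-Reasoning
  c = bernOverFact
  swap : ∀ a b c → a * (b * c) ≡ b * (a * c)
  swap = solve-∀ ℚ-ring

-- Bernoulli and Euler polynomials

-- bernPoly t m = Bₘ(t)/m!; eulerPoly t has generating function -x eᵗˣ/(eˣ + 1).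
bernPoly : ℚ → Series
bernPoly t = exp t ⋆ bernOverFact

eulerPoly : ℚ → Series
eulerPoly t = exp t ⋆ twistedBern

bernPoly-+1 : ∀ t → bernPoly (t + 1ℚ) ≗ bernPoly t ⊕ shift (exp t)
bernPoly-+1 t = begin
  exp (t + 1ℚ) ⋆ c               ≈⟨ ⋆-congʳ c (exp-+ t 1ℚ) ⟨
  (exp t ⋆ exp 1ℚ) ⋆ c           ≈⟨ ⋆-assoc (exp t) (exp 1ℚ) c ⟩
  exp t ⋆ (exp 1ℚ ⋆ c)           ≈⟨ ⋆-congˡ (exp t) exp1-⋆-bernOverFact ⟩
  exp t ⋆ (c ⊕ X)                ≈⟨ ⋆-distribˡ-⊕ (exp t) c X ⟩
  exp t ⋆ c ⊕ exp t ⋆ X          ≈⟨ ⊕-congˡ (exp t ⋆ c) (⋆-X (exp t)) ⟩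
  bernPoly t ⊕ shift (exp t)     ∎
  where
  open ≗-Reasoning
  c = bernOverFact

eulerPoly-+1 : ∀ t → eulerPoly (t + 1ℚ) ⊕ eulerPoly t ≗ (- 1ℚ) ⊛ shift (exp t)
eulerPoly-+1 t = begin
  exp (t + 1ℚ) ⋆ d ⊕ exp t ⋆ d                ≈⟨ ⊕-cong (⋆-congʳ d (exp-+ t 1ℚ)) (⋆-congˡ (exp t) (⋆-identityˡ d)) ⟨
  (exp t ⋆ exp 1ℚ) ⋆ d ⊕ exp t ⋆ (𝟙 ⋆ d)      ≈⟨ ⊕-cong (⋆-assoc (exp t) (exp 1ℚ) d) (λ _ → refl) ⟩
  exp t ⋆ (exp 1ℚ ⋆ d) ⊕ exp t ⋆ (𝟙 ⋆ d)      ≈⟨ ⋆-distribˡ-⊕ (exp t) (exp 1ℚ ⋆ d) (𝟙 ⋆ d) ⟨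
  exp t ⋆ (exp 1ℚ ⋆ d ⊕ 𝟙 ⋆ d)                ≈⟨ ⋆-congˡ (exp t) (⋆-distribʳ-⊕ d (exp 1ℚ) 𝟙) ⟨
  exp t ⋆ ((exp 1ℚ ⊕ 𝟙) ⋆ d)                  ≈⟨ ⋆-congˡ (exp t) exp1⊕𝟙-⋆-twistedBern ⟩
  exp t ⋆ ((- 1ℚ) ⊛ X)                        ≈⟨ ⋆-⊛-comm (- 1ℚ) (exp t) X ⟩
  (- 1ℚ) ⊛ (exp t ⋆ X)                        ≈⟨ ⊛-congˡ (- 1ℚ) (⋆-X (exp t)) ⟩
  (- 1ℚ) ⊛ shift (exp t)                      ∎
  where
  open ≗-Reasoning
  d = twistedBern

bernPoly-1 : bernPoly 1ℚ ≗ alt bernOverFact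
bernPoly-1 m = trans (exp1-⋆-bernOverFact m) (sym (alt-bernOverFact m))

eulerPoly-1 : eulerPoly 1ℚ ≗ (- 1ℚ) ⊛ alt twistedBern
eulerPoly-1 m = begin
  eulerPoly 1ℚ m                     ≡⟨ isolate sum≡ ⟩
  (- 1ℚ) * (d m + X m)               ≡⟨ cong ((- 1ℚ) *_) (alt-twistedBern m) ⟨
  (- 1ℚ) * alt d m                   ∎
  where
  open ≡-Reasoning
  d = twistedBern
  sum≡ : eulerPoly 1ℚ m + d m ≡ (- 1ℚ) * X m
  sum≡ = begin
    (exp 1ℚ ⋆ d) m + d m                 ≡⟨ cong ((exp 1ℚ ⋆ d) m +_) (⋆-identityˡ d m) ⟨
    (exp 1ℚ ⋆ d) m + (𝟙 ⋆ d) m           ≡⟨ ⋆-distribʳ-⊕ d (exp 1ℚ) 𝟙 m ⟨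
    ((exp 1ℚ ⊕ 𝟙) ⋆ d) m                 ≡⟨ exp1⊕𝟙-⋆-twistedBern m ⟩
    (- 1ℚ) * X m                         ∎
  isolate : ∀ {x y z} → x + y ≡ (- 1ℚ) * z → x ≡ (- 1ℚ) * (y + z)
  isolate {x} {y} {z} x+y≡-z = trans (unshift x y) (trans (cong (_- y) x+y≡-z) (regroup y z))
    where
    unshift : ∀ x y → x ≡ (x + y) - y
    unshift = solve-∀ ℚ-ring
    regroup : ∀ y z → (- 1ℚ) * z - y ≡ (- 1ℚ) * (y + z)
    regroup = solve-∀ ℚ-ring

θ-liCoeff : ∀ s α → θ (liCoeff (suc s) α) ≗ ℕ→ℚ (suc s) ⊛ liCoeff (suc (suc s)) α
θ-liCoeff s α zero    = trans (*-zeroˡ 0ℚ) (sym (*-zeroʳ (ℕ→ℚ (suc s))))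
θ-liCoeff s α (suc k) = begin
  m * (η * ℕ→ℚ (suc k ℕ.^ s) * invFact s)                ≡⟨ cong (λ x → m * (η * ℕ→ℚ (suc k ℕ.^ s) * x)) (invFact-suc s) ⟨
  m * (η * ℕ→ℚ (suc k ℕ.^ s) * (n * invFact (suc s)))    ≡⟨ regroup m η (ℕ→ℚ (suc k ℕ.^ s)) n (invFact (suc s)) ⟩
  n * (η * (m * ℕ→ℚ (suc k ℕ.^ s)) * invFact (suc s))    ≡⟨ cong (λ x → n * (η * x * invFact (suc s))) (ℕ→ℚ-* (suc k) (suc k ℕ.^ s)) ⟨
  n * (η * ℕ→ℚ (suc k ℕ.^ suc s) * invFact (suc s))      ∎
  where
  open ≡-Reasoning
  m = ℕ→ℚ (suc k); n = ℕ→ℚ (suc s); η = etaPow α (suc k)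
  regroup : ∀ m η p n i → m * (η * p * (n * i)) ≡ n * (η * (m * p) * i)
  regroup = solve-∀ ℚ-ring

liCoeff-1 : ∀ β m → liCoeff 1 β (suc m) ≡ etaPow β (suc m)
liCoeff-1 β m = trans (*-identityʳ (etaPow β (suc m) * 1ℚ)) (*-identityʳ (etaPow β (suc m)))

liCoeff-exp : ∀ s m → liCoeff (suc s) zero (suc m) ≡ exp (ℕ→ℚ (suc m)) s
liCoeff-exp s m = cong (_* invFact s) (trans (*-identityˡ (ℕ→ℚ (suc m ℕ.^ s))) (ℕ→ℚ-^ (suc m) s))

liCoeff-opposite : ∀ s α → liCoeff s (opposite α) ≗ alt (liCoeff s α)
liCoeff-opposite s α          zero    = sym (*-zeroʳ 1ℚ)
liCoeff-opposite s zero       (suc k) = regroup (negOnePow (suc k)) (ℕ→ℚ (suc k ℕ.^ (s ∸ 1))) (invFact (s ∸ 1))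
  where
  regroup : ∀ e p i → e * p * i ≡ e * (1ℚ * p * i)
  regroup = solve-∀ ℚ-ring
liCoeff-opposite s (suc zero) (suc k) = begin
  1ℚ * p * i                  ≡⟨ cong (λ x → x * p * i) (negOnePow-square (suc k)) ⟨
  e * e * p * i               ≡⟨ regroup e p i ⟩
  e * (e * p * i)             ∎
  where
  open ≡-Reasoning
  e = negOnePow (suc k); p = ℕ→ℚ (suc k ℕ.^ (s ∸ 1)); i = invFact (s ∸ 1)
  regroup : ∀ e p i → e * e * p * i ≡ e * (e * p * i)
  regroup = solve-∀ ℚ-ring

sumBelow-liCoeff≡bernPoly : ∀ p m →
  sumBelow (suc m) (liCoeff (suc p) zero) ≡ bernPoly (ℕ→ℚ (suc m)) (suc p) - bernPoly 1ℚ (suc p)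
sumBelow-liCoeff≡bernPoly p m = begin
  sumBelow (suc m) (liCoeff (suc p) zero)               ≡⟨ sumBelow-suc m (liCoeff (suc p) zero) ⟩
  0ℚ + sumBelow m (liCoeff (suc p) zero ∘ suc)          ≡⟨ +-identityˡ _ ⟩
  sumBelow m (liCoeff (suc p) zero ∘ suc)               ≡⟨ sumBelow-cong m difference ⟩
  sumBelow m (λ k → F (suc k) - F k)                    ≡⟨ sumBelow-telescope F m ⟩
  F m - F 0                                             ∎
  where
  open ≡-Reasoning
  F : ℕ → ℚ
  F k = bernPoly (ℕ→ℚ (suc k)) (suc p)
  cancel : ∀ a b → b ≡ (a + b) - a
  cancel = solve-∀ ℚ-ring
  difference : ∀ k → liCoeff (suc p) zero (suc k) ≡ F (suc k) - F k
  difference k = begin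
    liCoeff (suc p) zero (suc k)                  ≡⟨ liCoeff-exp p k ⟩
    exp t p                                       ≡⟨ cancel (F k) (exp t p) ⟩
    (F k + exp t p) - F k                         ≡⟨ cong (_- F k) (bernPoly-+1 t (suc p)) ⟨
    bernPoly (t + 1ℚ) (suc p) - F k               ≡⟨ cong (λ u → bernPoly u (suc p) - F k) (ℕ→ℚ-suc (suc k)) ⟨
    F (suc k) - F k                               ∎
    where t = ℕ→ℚ (suc k)

sumBelow-alt-liCoeff≡eulerPoly : ∀ p m →
  sumBelow (suc m) (alt (liCoeff (suc p) zero)) ≡
  eulerPoly 1ℚ (suc p) + negOnePow (suc m) * eulerPoly (ℕ→ℚ (suc m)) (suc p)
sumBelow-alt-liCoeff≡eulerPoly p m = begin
  sumBelow (suc m) (alt (liCoeff (suc p) zero))                ≡⟨ sumBelow-suc m (alt (liCoeff (suc p) zero)) ⟩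
  1ℚ * 0ℚ + sumBelow m (alt (liCoeff (suc p) zero) ∘ suc)      ≡⟨ +-identityˡ _ ⟩
  sumBelow m (alt (liCoeff (suc p) zero) ∘ suc)                ≡⟨ sumBelow-cong m sum ⟩
  sumBelow m (λ k → negOnePow k * (G (suc k) + G k))           ≡⟨ sumBelow-alternating-telescope G m ⟩
  G 0 + negOnePow (suc m) * G m                                ∎
  where
  open ≡-Reasoning
  G : ℕ → ℚ
  G k = eulerPoly (ℕ→ℚ (suc k)) (suc p)
  regroup : ∀ e x → - e * x ≡ e * ((- 1ℚ) * x)
  regroup = solve-∀ ℚ-ring
  sum : ∀ k → negOnePow (suc k) * liCoeff (suc p) zero (suc k) ≡ negOnePow k * (G (suc k) + G k)
  sum k = begin
    negOnePow (suc k) * liCoeff (suc p) zero (suc k)       ≡⟨ cong (negOnePow (suc k) *_) (liCoeff-exp p k) ⟩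
    - negOnePow k * exp t p                                ≡⟨ regroup (negOnePow k) (exp t p) ⟩
    negOnePow k * ((- 1ℚ) * exp t p)                       ≡⟨ cong (negOnePow k *_) (eulerPoly-+1 t (suc p)) ⟨
    negOnePow k * (eulerPoly (t + 1ℚ) (suc p) + G k)       ≡⟨ cong (λ u → negOnePow k * (eulerPoly u (suc p) + G k)) (ℕ→ℚ-suc (suc k)) ⟨
    negOnePow k * (G (suc k) + G k)                        ∎
    where t = ℕ→ℚ (suc k)

bernCoeff : Fin 2 → Series
bernCoeff zero       = bernOverFact
bernCoeff (suc zero) = twistedBern

lambdaWith : Series → ℕ → ℕ → ℕ → ℚ
lambdaWith c j a b = negOnePow (b ∸ 1) * ℕ→ℚ ((a ℕ.+ b ∸ j ∸ 1) C (a ∸ j)) * c (a ℕ.+ b ∸ j)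

lambda≡lambdaWith : ∀ j a b γ → lambda j a b γ ≡ lambdaWith (bernCoeff γ) j a b
lambda≡lambdaWith j a b zero       = refl
lambda≡lambdaWith j a b (suc zero) = regroup (pow2 N) (negOnePow (b ∸ 1)) (ℕ→ℚ ((N ∸ 1) C (a ∸ j))) (bernOverFact N)
  where
  N = a ℕ.+ b ∸ j
  regroup : ∀ p s k c → (p - 1ℚ) * (s * k * c) ≡ s * k * ((p - 1ℚ) * c)
  regroup = solve-∀ ℚ-ring

nCk*k![n∸k]!≡n! : ∀ {n k} → k ≤ n → (n C k) ℕ.* (k ! ℕ.* (n ∸ k) !) ≡ n !
nCk*k![n∸k]!≡n! {n} {k} k≤n =
  trans (cong (ℕ._* (k ! ℕ.* (n ∸ k) !)) (nCk≡n!/k![n-k]! k≤n)) (m/n*n≡m {{k !* (n ∸ k) !≢0}} (k![n∸k]!∣n! k≤n))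

[1+k]*[k+1+m]C[1+k]≡[1+m]*[k+1+m]Ck : ∀ k m →
  suc k ℕ.* ((k ℕ.+ suc m) C suc k) ≡ suc m ℕ.* ((k ℕ.+ suc m) C k)
[1+k]*[k+1+m]C[1+k]≡[1+m]*[k+1+m]Ck k m =
  ℕ.*-cancelʳ-≡ _ _ (k ! ℕ.* m !) {{k !* m !≢0}} (trans left (sym right))
  where
  n = k ℕ.+ suc m
  regroupˡ : ∀ x c y z → x ℕ.* c ℕ.* (y ℕ.* z) ≡ c ℕ.* (x ℕ.* y ℕ.* z)
  regroupˡ = ℕ-Solver.solve-∀
  regroupʳ : ∀ x c y z → x ℕ.* c ℕ.* (y ℕ.* z) ≡ c ℕ.* (y ℕ.* (x ℕ.* z))
  regroupʳ = ℕ-Solver.solve-∀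
  n∸[1+k]≡m : n ∸ suc k ≡ m
  n∸[1+k]≡m = trans (cong (_∸ suc k) (ℕ.+-suc k m)) (ℕ.m+n∸m≡n k m)
  left : suc k ℕ.* (n C suc k) ℕ.* (k ! ℕ.* m !) ≡ n !
  left = begin
    suc k ℕ.* (n C suc k) ℕ.* (k ! ℕ.* m !)        ≡⟨ regroupˡ (suc k) (n C suc k) (k !) (m !) ⟩
    (n C suc k) ℕ.* (suc k ! ℕ.* m !)              ≡⟨ cong (λ i → (n C suc k) ℕ.* (suc k ! ℕ.* i !)) n∸[1+k]≡m ⟨
    (n C suc k) ℕ.* (suc k ! ℕ.* (n ∸ suc k) !)    ≡⟨ nCk*k![n∸k]!≡n! (subst (suc k ≤_) (sym (ℕ.+-suc k m)) (s≤s (ℕ.m≤m+n k m))) ⟩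
    n !                                            ∎
    where open ≡-Reasoning
  right : suc m ℕ.* (n C k) ℕ.* (k ! ℕ.* m !) ≡ n !
  right = begin
    suc m ℕ.* (n C k) ℕ.* (k ! ℕ.* m !)            ≡⟨ regroupʳ (suc m) (n C k) (k !) (m !) ⟩
    (n C k) ℕ.* (k ! ℕ.* suc m !)                  ≡⟨ cong (λ i → (n C k) ℕ.* (k ! ℕ.* i !)) (ℕ.m+n∸m≡n k (suc m)) ⟨
    (n C k) ℕ.* (k ! ℕ.* (n ∸ k) !)                ≡⟨ nCk*k![n∸k]!≡n! (ℕ.m≤m+n k (suc m)) ⟩
    n !                                            ∎
    where open ≡-Reasoning

lambda-suc : ∀ j a b γ → lambda (suc j) (suc a) b γ ≡ lambda j a b γ
lambda-suc j a b γ = trans (lambda≡lambdaWith (suc j) (suc a) b γ) (sym (lambda≡lambdaWith j a b γ))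

suc-+-∸ : ∀ i u → suc (i ℕ.+ u) ∸ i ≡ suc u
suc-+-∸ i u = trans (cong (_∸ i) (sym (ℕ.+-suc i u))) (ℕ.m+n∸m≡n i (suc u))

-- For a = j + u + 1 and b = v + 1 both λ's involve the same c_{u+b+1}; what remains
-- is the binomial identity above.
lambdaWith-recurrence : ∀ c j u v →
  ℕ→ℚ (suc u) * lambdaWith c j (suc (j ℕ.+ u)) (suc v) +
  ℕ→ℚ (suc v) * lambdaWith c (suc j) (suc (j ℕ.+ u)) (suc (suc v)) ≡ 0ℚ
lambdaWith-recurrence c j u v = begin
  k₁ * lambdaWith c j a b + k₂ * lambdaWith c (suc j) a (suc b)
    ≡⟨ cong₂ (λ x y → k₁ * x + k₂ * y) first second ⟩
  k₁ * (s * C₁ * c N) + k₂ * (- s * C₂ * c N)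
    ≡⟨ regroup k₁ k₂ s C₁ C₂ (c N) ⟩
  s * c N * (k₁ * C₁) - s * c N * (k₂ * C₂)
    ≡⟨ cong (λ x → s * c N * x - s * c N * (k₂ * C₂)) binomial ⟩
  s * c N * (k₂ * C₂) - s * c N * (k₂ * C₂)
    ≡⟨ +-inverseʳ (s * c N * (k₂ * C₂)) ⟩
  0ℚ
    ∎
  where
  open ≡-Reasoning
  a = suc (j ℕ.+ u); b = suc v; N = suc (u ℕ.+ b)
  k₁ = ℕ→ℚ (suc u); k₂ = ℕ→ℚ b; s = negOnePow v
  C₁ = ℕ→ℚ ((u ℕ.+ b) C suc u); C₂ = ℕ→ℚ ((u ℕ.+ b) C u)
  regroup : ∀ k₁ k₂ s C₁ C₂ c → k₁ * (s * C₁ * c) + k₂ * (- s * C₂ * c) ≡ s * c * (k₁ * C₁) - s * c * (k₂ * C₂)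
  regroup = solve-∀ ℚ-ring
  first : lambdaWith c j a b ≡ s * C₁ * c N
  first = cong₂ (λ M A → s * ℕ→ℚ ((M ∸ 1) C A) * c M)
    (trans (cong (λ x → suc x ∸ j) (ℕ.+-assoc j u b)) (suc-+-∸ j (u ℕ.+ b))) (suc-+-∸ j u)
  second : lambdaWith c (suc j) a (suc b) ≡ - s * C₂ * c N
  second = cong₂ (λ M A → negOnePow b * ℕ→ℚ ((M ∸ 1) C A) * c M)
    (trans (cong (_∸ j) (ℕ.+-assoc j u (suc b))) (trans (ℕ.m+n∸m≡n j (u ℕ.+ suc b)) (ℕ.+-suc u b)))
    (ℕ.m+n∸m≡n j u)
  binomial : k₁ * C₁ ≡ k₂ * C₂
  binomial = begin
    k₁ * C₁                                  ≡⟨ ℕ→ℚ-* (suc u) ((u ℕ.+ b) C suc u) ⟨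
    ℕ→ℚ (suc u ℕ.* ((u ℕ.+ b) C suc u))      ≡⟨ cong ℕ→ℚ ([1+k]*[k+1+m]C[1+k]≡[1+m]*[k+1+m]Ck u v) ⟩
    ℕ→ℚ (b ℕ.* ((u ℕ.+ b) C u))              ≡⟨ ℕ→ℚ-* b ((u ℕ.+ b) C u) ⟩
    k₂ * C₂                                  ∎

lambda-recurrence : ∀ γ {i a} b → i < a →
  ℕ→ℚ a * lambda (suc i) (suc a) (suc b) γ + ℕ→ℚ (suc b) * lambda (suc i) a (suc (suc b)) γ ≡
  ℕ→ℚ i * lambda i a (suc b) γ
lambda-recurrence γ {i} b i<a with ℕ.m≤n⇒∃[o]m+o≡n i<a
... | u , refl = begin
  ℕ→ℚ a * lambda (suc i) (suc a) (suc b) γ + k * lambda (suc i) a (suc (suc b)) γ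
    ≡⟨ cong₂ (λ x y → ℕ→ℚ a * x + k * y) (lambda≡lambdaWith (suc i) (suc a) (suc b) γ) (lambda≡lambdaWith (suc i) a (suc (suc b)) γ) ⟩
  ℕ→ℚ a * μ₁ + k * μ₂
    ≡⟨ cong (λ x → x * μ₁ + k * μ₂) (trans (cong ℕ→ℚ (sym (ℕ.+-suc i u))) (ℕ→ℚ-+ i (suc u))) ⟩
  (ℕ→ℚ i + ℕ→ℚ (suc u)) * μ₁ + k * μ₂
    ≡⟨ regroup (ℕ→ℚ i) (ℕ→ℚ (suc u)) μ₁ (k * μ₂) ⟩
  ℕ→ℚ i * μ₁ + (ℕ→ℚ (suc u) * μ₁ + k * μ₂)
    ≡⟨ cong (ℕ→ℚ i * μ₁ +_) (lambdaWith-recurrence (bernCoeff γ) i u b) ⟩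
  ℕ→ℚ i * μ₁ + 0ℚ
    ≡⟨ +-identityʳ (ℕ→ℚ i * μ₁) ⟩
  ℕ→ℚ i * μ₁
    ≡⟨ cong (ℕ→ℚ i *_) (lambda≡lambdaWith i a (suc b) γ) ⟨
  ℕ→ℚ i * lambda i a (suc b) γ
    ∎
  where
  open ≡-Reasoning
  a = suc (i ℕ.+ u); k = ℕ→ℚ (suc b)
  μ₁ = lambdaWith (bernCoeff γ) i a (suc b)
  μ₂ = lambdaWith (bernCoeff γ) (suc i) a (suc (suc b))
  regroup : ∀ x y z w → (x + y) * z + w ≡ x * z + (y * z + w)
  regroup = solve-∀ ℚ-ring

lambdaWith-b≡1 : ∀ c {i a} → i < a → lambdaWith c (suc i) a 1 ≡ c (a ∸ i)
lambdaWith-b≡1 c {i} i<a with ℕ.m≤n⇒∃[o]m+o≡n i<a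
... | u , refl = begin
  1ℚ * ℕ→ℚ ((M ∸ 1) C (i ℕ.+ u ∸ i)) * c M     ≡⟨ cong₂ (λ M A → 1ℚ * ℕ→ℚ ((M ∸ 1) C A) * c M) M≡1+u (ℕ.m+n∸m≡n i u) ⟩
  1ℚ * ℕ→ℚ (u C u) * c (suc u)                  ≡⟨ cong (λ x → 1ℚ * ℕ→ℚ x * c (suc u)) (nCn≡1 u) ⟩
  1ℚ * 1ℚ * c (suc u)                           ≡⟨ *-identityˡ (c (suc u)) ⟩
  c (suc u)                                     ≡⟨ cong c (suc-+-∸ i u) ⟨
  c (suc (i ℕ.+ u) ∸ i)                         ∎
  where
  open ≡-Reasoning
  M = i ℕ.+ u ℕ.+ 1 ∸ i
  M≡1+u : M ≡ suc u
  M≡1+u = trans (cong (_∸ i) (ℕ.+-assoc i u 1)) (trans (ℕ.m+n∸m≡n i (u ℕ.+ 1)) (ℕ.+-comm u 1))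

lambdaWith-a≡1 : ∀ c p → lambdaWith c 1 1 (suc p) ≡ negOnePow p * c (suc p)
lambdaWith-a≡1 c p = cong (_* c (suc p)) (*-identityʳ (negOnePow p))

-- The recurrence coming from θ = z d/dz

liSum : ℕ → ℕ → Fin 2 → Fin 2 → ℕ → ℚ
liSum a b γ α n = sumBelow a (λ i → lambda (suc i) a b γ * liCoeff (suc i) α n)

record θ-Recurrence (n : ℕ) (F : ℕ → ℕ → ℚ) : Set where
  constructor θ-recurrence
  field
    step : ∀ a b → ℕ→ℚ n * F (suc a) (suc b) ≡
                   ℕ→ℚ (suc a) * F (suc (suc a)) (suc b) + ℕ→ℚ (suc b) * F (suc a) (suc (suc b))

open θ-Recurrence

θ-recurrence-unique : ∀ {n F G} → θ-Recurrence n F → θ-Recurrence n G →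
  (∀ a → F (suc a) 1 ≡ G (suc a) 1) → ∀ a b → F (suc a) (suc b) ≡ G (suc a) (suc b)
θ-recurrence-unique recF recG F≡G a zero    = F≡G a
θ-recurrence-unique {n} {F} {G} recF recG F≡G a (suc b) = ℕ→ℚ-suc-*-cancelˡ b (begin
  ℕ→ℚ (suc b) * F (suc a) (suc (suc b))
    ≡⟨ isolate (step recF a b) ⟩
  ℕ→ℚ n * F (suc a) (suc b) - ℕ→ℚ (suc a) * F (suc (suc a)) (suc b)
    ≡⟨ cong₂ (λ x y → ℕ→ℚ n * x - ℕ→ℚ (suc a) * y)
             (θ-recurrence-unique recF recG F≡G a b) (θ-recurrence-unique recF recG F≡G (suc a) b) ⟩
  ℕ→ℚ n * G (suc a) (suc b) - ℕ→ℚ (suc a) * G (suc (suc a)) (suc b)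
    ≡⟨ isolate (step recG a b) ⟨
  ℕ→ℚ (suc b) * G (suc a) (suc (suc b))
    ∎)
  where
  open ≡-Reasoning
  isolate : ∀ {x y z} → x ≡ y + z → z ≡ x - y
  isolate {x} {y} {z} x≡y+z = trans (unshift y z) (cong (_- y) (sym x≡y+z))
    where
    unshift : ∀ y z → z ≡ (y + z) - y
    unshift = solve-∀ ℚ-ring

θ-recurrence-+ : ∀ {n F G} → θ-Recurrence n F → θ-Recurrence n G → θ-Recurrence n (λ a b → F a b + G a b)
θ-recurrence-+ {n} recF recG = θ-recurrence λ a b →
  combine (ℕ→ℚ n) (ℕ→ℚ (suc a)) (ℕ→ℚ (suc b)) (step recF a b) (step recG a b)
  where
  regroup : ∀ A B x₁ x₂ y₁ y₂ → (A * x₁ + B * x₂) + (A * y₁ + B * y₂) ≡ A * (x₁ + y₁) + B * (x₂ + y₂)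
  regroup = solve-∀ ℚ-ring
  combine : ∀ n A B {x y x₁ x₂ y₁ y₂} → n * x ≡ A * x₁ + B * x₂ → n * y ≡ A * y₁ + B * y₂ →
            n * (x + y) ≡ A * (x₁ + y₁) + B * (x₂ + y₂)
  combine n A B {x} {y} {x₁} {x₂} {y₁} {y₂} nx≡ ny≡ =
    trans (*-distribˡ-+ n x y) (trans (cong₂ _+_ nx≡ ny≡) (regroup A B x₁ x₂ y₁ y₂))

θ-recurrence-swap : ∀ {n F} → θ-Recurrence n F → θ-Recurrence n (λ a b → F b a)
θ-recurrence-swap {n} {F} recF = θ-recurrence λ a b →
  trans (step recF b a) (+-comm (ℕ→ℚ (suc b) * F (suc (suc b)) (suc a)) (ℕ→ℚ (suc a) * F (suc b) (suc (suc a))))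

θ-recurrence-product : ∀ α β n → θ-Recurrence n (λ a b → (liCoeff a α ⋆ liCoeff b β) n)
θ-recurrence-product α β n = θ-recurrence λ a b → begin
  θ (liCoeff (suc a) α ⋆ liCoeff (suc b) β) n
    ≡⟨ θ-⋆ (liCoeff (suc a) α) (liCoeff (suc b) β) n ⟩
  (θ (liCoeff (suc a) α) ⋆ liCoeff (suc b) β) n + (liCoeff (suc a) α ⋆ θ (liCoeff (suc b) β)) n
    ≡⟨ cong₂ _+_ (⋆-congʳ (liCoeff (suc b) β) (θ-liCoeff a α) n) (⋆-congˡ (liCoeff (suc a) α) (θ-liCoeff b β) n) ⟩
  ((ℕ→ℚ (suc a) ⊛ liCoeff (suc (suc a)) α) ⋆ liCoeff (suc b) β) n + (liCoeff (suc a) α ⋆ (ℕ→ℚ (suc b) ⊛ liCoeff (suc (suc b)) β)) n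
    ≡⟨ cong₂ _+_ (⊛-⋆-assoc (ℕ→ℚ (suc a)) (liCoeff (suc (suc a)) α) (liCoeff (suc b) β) n)
                 (⋆-⊛-comm (ℕ→ℚ (suc b)) (liCoeff (suc a) α) (liCoeff (suc (suc b)) β) n) ⟩
  ℕ→ℚ (suc a) * (liCoeff (suc (suc a)) α ⋆ liCoeff (suc b) β) n + ℕ→ℚ (suc b) * (liCoeff (suc a) α ⋆ liCoeff (suc (suc b)) β) n
    ∎
  where open ≡-Reasoning

θ-recurrence-liCoeff-+ : ∀ δ α n → θ-Recurrence n (λ a b → δ * liCoeff (a ℕ.+ b) α n)
θ-recurrence-liCoeff-+ δ α n = θ-recurrence λ a b → begin
  ℕ→ℚ n * (δ * L (suc a ℕ.+ suc b))
    ≡⟨ swap (ℕ→ℚ n) δ (L (suc a ℕ.+ suc b)) ⟩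
  δ * (ℕ→ℚ n * L (suc (a ℕ.+ suc b)))
    ≡⟨ cong (δ *_) (θ-liCoeff (a ℕ.+ suc b) α n) ⟩
  δ * (ℕ→ℚ (suc a ℕ.+ suc b) * L (suc (suc a) ℕ.+ suc b))
    ≡⟨ cong (λ x → δ * (x * L (suc (suc a) ℕ.+ suc b))) (ℕ→ℚ-+ (suc a) (suc b)) ⟩
  δ * ((ℕ→ℚ (suc a) + ℕ→ℚ (suc b)) * L (suc (suc a) ℕ.+ suc b))
    ≡⟨ distrib δ (ℕ→ℚ (suc a)) (ℕ→ℚ (suc b)) (L (suc (suc a) ℕ.+ suc b)) ⟩
  ℕ→ℚ (suc a) * (δ * L (suc (suc a) ℕ.+ suc b)) + ℕ→ℚ (suc b) * (δ * L (suc (suc a) ℕ.+ suc b))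
    ≡⟨ cong (λ i → ℕ→ℚ (suc a) * (δ * L (suc (suc a) ℕ.+ suc b)) + ℕ→ℚ (suc b) * (δ * L i)) (ℕ.+-suc (suc a) (suc b)) ⟨
  ℕ→ℚ (suc a) * (δ * L (suc (suc a) ℕ.+ suc b)) + ℕ→ℚ (suc b) * (δ * L (suc a ℕ.+ suc (suc b)))
    ∎
  where
  open ≡-Reasoning
  L = λ s → liCoeff s α n
  swap : ∀ x y z → x * (y * z) ≡ y * (x * z)
  swap = solve-∀ ℚ-ring
  distrib : ∀ d x y l → d * ((x + y) * l) ≡ x * (d * l) + y * (d * l)
  distrib = solve-∀ ℚ-ring

liSum-θ : ∀ a b γ α n →
  ℕ→ℚ n * liSum a b γ α n ≡ sumBelow (suc a) (λ i → ℕ→ℚ i * lambda i a b γ * liCoeff (suc i) α n)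
liSum-θ a b γ α n = begin
  ℕ→ℚ n * sumBelow a (λ i → λ′ (suc i) * L (suc i))
    ≡⟨ *-distribˡ-sumBelow a (ℕ→ℚ n) (λ i → λ′ (suc i) * L (suc i)) ⟩
  sumBelow a (λ i → ℕ→ℚ n * (λ′ (suc i) * L (suc i)))
    ≡⟨ sumBelow-cong a term ⟩
  sumBelow a (h ∘ suc)
    ≡⟨ +-identityˡ (sumBelow a (h ∘ suc)) ⟨
  0ℚ + sumBelow a (h ∘ suc)
    ≡⟨ cong (_+ sumBelow a (h ∘ suc)) (trans (cong (_* L 1) (*-zeroˡ (λ′ 0))) (*-zeroˡ (L 1))) ⟨
  h 0 + sumBelow a (h ∘ suc)
    ≡⟨ sumBelow-suc a h ⟨
  sumBelow (suc a) h
    ∎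
  where
  open ≡-Reasoning
  λ′ = λ j → lambda j a b γ
  L = λ s → liCoeff s α n
  h = λ i → ℕ→ℚ i * λ′ i * L (suc i)
  regroup : ∀ n l x → n * (l * x) ≡ l * (n * x)
  regroup = solve-∀ ℚ-ring
  reorder : ∀ l s y → l * (s * y) ≡ s * l * y
  reorder = solve-∀ ℚ-ring
  term : ∀ i → ℕ→ℚ n * (λ′ (suc i) * L (suc i)) ≡ h (suc i)
  term i = begin
    ℕ→ℚ n * (λ′ (suc i) * L (suc i))                     ≡⟨ regroup (ℕ→ℚ n) (λ′ (suc i)) (L (suc i)) ⟩
    λ′ (suc i) * (ℕ→ℚ n * L (suc i))                     ≡⟨ cong (λ′ (suc i) *_) (θ-liCoeff i α n) ⟩
    λ′ (suc i) * (ℕ→ℚ (suc i) * L (suc (suc i)))         ≡⟨ reorder (λ′ (suc i)) (ℕ→ℚ (suc i)) (L (suc (suc i))) ⟩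
    h (suc i)                                            ∎

liSum-recurrence : ∀ a b γ α n →
  ℕ→ℚ (suc a) * liSum (suc (suc a)) (suc b) γ α n + ℕ→ℚ (suc b) * liSum (suc a) (suc (suc b)) γ α n ≡
  sumBelow (suc (suc a)) (λ i → ℕ→ℚ i * lambda i (suc a) (suc b) γ * liCoeff (suc i) α n)
liSum-recurrence a b γ α n = begin
  A * (sumBelow (suc a) σ₁ + σ₁ (suc a)) + B * sumBelow (suc a) σ₂
    ≡⟨ regroup A B (sumBelow (suc a) σ₁) (σ₁ (suc a)) (sumBelow (suc a) σ₂) ⟩
  (A * sumBelow (suc a) σ₁ + B * sumBelow (suc a) σ₂) + A * σ₁ (suc a)
    ≡⟨ cong (_+ A * σ₁ (suc a)) (cong₂ _+_ (*-distribˡ-sumBelow (suc a) A σ₁) (*-distribˡ-sumBelow (suc a) B σ₂)) ⟩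
  (sumBelow (suc a) (λ i → A * σ₁ i) + sumBelow (suc a) (λ i → B * σ₂ i)) + A * σ₁ (suc a)
    ≡⟨ cong (_+ A * σ₁ (suc a)) (sumBelow-distrib-+ (suc a) (λ i → A * σ₁ i) (λ i → B * σ₂ i)) ⟨
  sumBelow (suc a) (λ i → A * σ₁ i + B * σ₂ i) + A * σ₁ (suc a)
    ≡⟨ cong₂ _+_ (sumBelow-cong-< (suc a) lower) top ⟩
  sumBelow (suc a) h + h (suc a)
    ∎
  where
  open ≡-Reasoning
  A = ℕ→ℚ (suc a); B = ℕ→ℚ (suc b)
  L = λ s → liCoeff s α n
  σ₁ = λ i → lambda (suc i) (suc (suc a)) (suc b) γ * L (suc i)
  σ₂ = λ i → lambda (suc i) (suc a) (suc (suc b)) γ * L (suc i)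
  h = λ i → ℕ→ℚ i * lambda i (suc a) (suc b) γ * L (suc i)
  regroup : ∀ A B s x t → A * (s + x) + B * t ≡ (A * s + B * t) + A * x
  regroup = solve-∀ ℚ-ring
  factor : ∀ A B x y l → A * (x * l) + B * (y * l) ≡ (A * x + B * y) * l
  factor = solve-∀ ℚ-ring
  lower : ∀ i → i < suc a → A * σ₁ i + B * σ₂ i ≡ h i
  lower i i<a = trans (factor A B _ _ (L (suc i))) (cong (_* L (suc i)) (lambda-recurrence γ b i<a))
  top : A * σ₁ (suc a) ≡ h (suc a)
  top = trans (sym (*-assoc A _ (L (suc (suc a))))) (cong (λ x → A * x * L (suc (suc a))) (lambda-suc (suc a) (suc a) (suc b) γ))

θ-recurrence-liSum : ∀ γ α n → θ-Recurrence n (λ a b → liSum a b γ α n)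
θ-recurrence-liSum γ α n = θ-recurrence λ a b → trans (liSum-θ (suc a) (suc b) γ α n) (sym (liSum-recurrence a b γ α n))

θ-recurrence-rhsCoeff : ∀ α β n → θ-Recurrence n (λ a b → rhsCoeff a b α β n)
θ-recurrence-rhsCoeff α β n =
  θ-recurrence-+ (θ-recurrence-+ (θ-recurrence-liSum (α ⊖₂ β) α n)
                                 (θ-recurrence-swap (θ-recurrence-liSum (β ⊖₂ α) β n)))
                 (θ-recurrence-liCoeff-+ (δ₂ α β) α n)

-- The case b = 1

⋆-split : ∀ f g a → (f ⋆ g) a ≡ sumBelow a (λ i → g (a ∸ i) * f i) + f a * g 0
⋆-split f g a = cong₂ _+_ (sumBelow-cong a (λ i → *-comm (f i) (g (a ∸ i)))) (cong (λ k → f a * g k) (ℕ.n∸n≡0 a))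

⋆-liCoeff-1 : ∀ f β m → (f ⋆ liCoeff 1 β) (suc m) ≡ sumBelow (suc m) (λ k → f k * etaPow β (suc m ∸ k))
⋆-liCoeff-1 f β m = begin
  sumBelow (suc m) (λ k → f k * liCoeff 1 β (suc m ∸ k)) + f (suc m) * liCoeff 1 β (m ∸ m)
    ≡⟨ cong₂ _+_ (sumBelow-cong-< (suc m) lower) top ⟩
  sumBelow (suc m) (λ k → f k * etaPow β (suc m ∸ k)) + 0ℚ
    ≡⟨ +-identityʳ _ ⟩
  sumBelow (suc m) (λ k → f k * etaPow β (suc m ∸ k))
    ∎
  where
  open ≡-Reasoning
  lower : ∀ k → k < suc m → f k * liCoeff 1 β (suc m ∸ k) ≡ f k * etaPow β (suc m ∸ k)
  lower k k≤m rewrite ℕ.+-∸-assoc 1 (ℕ.≤-pred k≤m) = cong (f k *_) (liCoeff-1 β (m ∸ k))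
  top : f (suc m) * liCoeff 1 β (m ∸ m) ≡ 0ℚ
  top rewrite ℕ.n∸n≡0 m = *-zeroʳ (f (suc m))

0⊖₂β≡β : ∀ β → zero ⊖₂ β ≡ β
0⊖₂β≡β zero       = refl
0⊖₂β≡β (suc zero) = refl

β⊖₂0≡β : ∀ β → β ⊖₂ zero ≡ β
β⊖₂0≡β zero       = refl
β⊖₂0≡β (suc zero) = refl

rhsCoeff-b≡1 : ∀ p β m →
  rhsCoeff (suc p) 1 zero β (suc m) ≡
  sumBelow (suc p) (λ i → bernCoeff β (suc p ∸ i) * exp (ℕ→ℚ (suc m)) i)
    + negOnePow p * bernCoeff β (suc p) * etaPow β (suc m)
    + δ₂ zero β * exp (ℕ→ℚ (suc m)) (suc p)
rhsCoeff-b≡1 p β m = cong₂ _+_ (cong₂ _+_ first second) third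
  where
  first : liSum (suc p) 1 (zero ⊖₂ β) zero (suc m) ≡ sumBelow (suc p) (λ i → bernCoeff β (suc p ∸ i) * exp (ℕ→ℚ (suc m)) i)
  first = sumBelow-cong-< (suc p) λ i i<a → cong₂ _*_
    (trans (lambda≡lambdaWith (suc i) (suc p) 1 (zero ⊖₂ β))
           (trans (lambdaWith-b≡1 (bernCoeff (zero ⊖₂ β)) i<a) (cong (λ γ → bernCoeff γ (suc p ∸ i)) (0⊖₂β≡β β))))
    (liCoeff-exp i m)
  second : liSum 1 (suc p) (β ⊖₂ zero) β (suc m) ≡ negOnePow p * bernCoeff β (suc p) * etaPow β (suc m)
  second = trans (+-identityˡ _) (cong₂ _*_
    (trans (lambda≡lambdaWith 1 1 (suc p) (β ⊖₂ zero))
           (trans (lambdaWith-a≡1 (bernCoeff (β ⊖₂ zero)) p) (cong (λ γ → negOnePow p * bernCoeff γ (suc p)) (β⊖₂0≡β β))))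
    (liCoeff-1 β m))
  third : δ₂ zero β * liCoeff (suc p ℕ.+ 1) zero (suc m) ≡ δ₂ zero β * exp (ℕ→ℚ (suc m)) (suc p)
  third = cong (δ₂ zero β *_) (trans (liCoeff-exp (p ℕ.+ 1) m) (cong (exp (ℕ→ℚ (suc m))) (ℕ.+-comm p 1)))

product-formula-b≡1-β≡0 : ∀ p m →
  (liCoeff (suc p) zero ⋆ liCoeff 1 zero) (suc m) ≡ rhsCoeff (suc p) 1 zero zero (suc m)
product-formula-b≡1-β≡0 p m = begin
  (L ⋆ liCoeff 1 zero) (suc m)                    ≡⟨ ⋆-liCoeff-1 L zero m ⟩
  sumBelow (suc m) (λ k → L k * 1ℚ)               ≡⟨ sumBelow-cong (suc m) (λ k → *-identityʳ (L k)) ⟩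
  sumBelow (suc m) L                              ≡⟨ sumBelow-liCoeff≡bernPoly p m ⟩
  bernPoly t a - bernPoly 1ℚ a                    ≡⟨ cong₂ _-_ (⋆-split (exp t) c a) (bernPoly-1 a) ⟩
  (S + exp t a * 1ℚ) - negOnePow a * c a          ≡⟨ regroup S (exp t a) (negOnePow p) (c a) ⟩
  S + negOnePow p * c a * 1ℚ + 1ℚ * exp t a       ≡⟨ rhsCoeff-b≡1 p zero m ⟨
  rhsCoeff a 1 zero zero (suc m)                  ∎
  where
  open ≡-Reasoning
  a = suc p; t = ℕ→ℚ (suc m); c = bernOverFact
  L = liCoeff a zero
  S = sumBelow a (λ i → c (a ∸ i) * exp t i)
  regroup : ∀ S x s c → (S + x * 1ℚ) - (- s) * c ≡ S + s * c * 1ℚ + 1ℚ * x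
  regroup = solve-∀ ℚ-ring

product-formula-b≡1-β≡1 : ∀ p m →
  (liCoeff (suc p) zero ⋆ liCoeff 1 (suc zero)) (suc m) ≡ rhsCoeff (suc p) 1 zero (suc zero) (suc m)
product-formula-b≡1-β≡1 p m = begin
  (L ⋆ liCoeff 1 (suc zero)) (suc m)                     ≡⟨ ⋆-liCoeff-1 L (suc zero) m ⟩
  sumBelow (suc m) (λ k → L k * negOnePow (suc m ∸ k))   ≡⟨ sumBelow-cong-< (suc m) sign ⟩
  sumBelow (suc m) (λ k → e * alt L k)                   ≡⟨ *-distribˡ-sumBelow (suc m) e (alt L) ⟨
  e * sumBelow (suc m) (alt L)                           ≡⟨ cong (e *_) (sumBelow-alt-liCoeff≡eulerPoly p m) ⟩
  e * (eulerPoly 1ℚ a + e * eulerPoly t a)               ≡⟨ cong₂ (λ x y → e * (x + e * y)) (eulerPoly-1 a) (⋆-split (exp t) d a) ⟩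
  e * ((- 1ℚ) * (- s * d a) + e * (S + exp t a * 0ℚ))    ≡⟨ regroup e s (d a) S (exp t a) ⟩
  e * e * S + s * d a * e                                ≡⟨ cong (λ x → x * S + s * d a * e) (negOnePow-square (suc m)) ⟩
  1ℚ * S + s * d a * e                                   ≡⟨ tidy S (s * d a * e) (exp t a) ⟩
  S + s * d a * e + 0ℚ * exp t a                         ≡⟨ rhsCoeff-b≡1 p (suc zero) m ⟨
  rhsCoeff a 1 zero (suc zero) (suc m)                   ∎
  where
  open ≡-Reasoning
  a = suc p; t = ℕ→ℚ (suc m); d = twistedBern
  e = negOnePow (suc m); s = negOnePow p
  L = liCoeff a zero
  S = sumBelow a (λ i → d (a ∸ i) * exp t i)
  regroup : ∀ e s d S x → e * ((- 1ℚ) * (- s * d) + e * (S + x * 0ℚ)) ≡ e * e * S + s * d * e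
  regroup = solve-∀ ℚ-ring
  tidy : ∀ S y x → 1ℚ * S + y ≡ S + y + 0ℚ * x
  tidy = solve-∀ ℚ-ring
  swap : ∀ l e s → l * (e * s) ≡ e * (s * l)
  swap = solve-∀ ℚ-ring
  sign : ∀ k → k < suc m → L k * negOnePow (suc m ∸ k) ≡ e * alt L k
  sign k k≤m = trans (cong (L k *_) (negOnePow-∸ (ℕ.<⇒≤ k≤m))) (swap (L k) e (negOnePow k))

rhsCoeff-0 : ∀ a b α β → rhsCoeff a b α β 0 ≡ 0ℚ
rhsCoeff-0 a b α β = cong₂ _+_ (cong₂ _+_ (liSum-0 a b (α ⊖₂ β) α) (liSum-0 b a (β ⊖₂ α) β)) (*-zeroʳ (δ₂ α β))
  where
  liSum-0 : ∀ a b γ α → liSum a b γ α 0 ≡ 0ℚ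
  liSum-0 a b γ α = trans (sumBelow-cong a (λ i → *-zeroʳ (lambda (suc i) a b γ))) (sumBelow-0 a)

product-formula-b≡1-α≡0 : ∀ p β n → (liCoeff (suc p) zero ⋆ liCoeff 1 β) n ≡ rhsCoeff (suc p) 1 zero β n
product-formula-b≡1-α≡0 p β          zero    = sym (rhsCoeff-0 (suc p) 1 zero β)
product-formula-b≡1-α≡0 p zero       (suc m) = product-formula-b≡1-β≡0 p m
product-formula-b≡1-α≡0 p (suc zero) (suc m) = product-formula-b≡1-β≡1 p m

-- The symmetry z ↦ -z

⊖₂-opposite : ∀ α β → opposite α ⊖₂ opposite β ≡ α ⊖₂ β
⊖₂-opposite zero       zero       = refl
⊖₂-opposite zero       (suc zero) = refl
⊖₂-opposite (suc zero) zero       = refl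
⊖₂-opposite (suc zero) (suc zero) = refl

δ₂-opposite : ∀ α β → δ₂ (opposite α) (opposite β) ≡ δ₂ α β
δ₂-opposite zero       zero       = refl
δ₂-opposite zero       (suc zero) = refl
δ₂-opposite (suc zero) zero       = refl
δ₂-opposite (suc zero) (suc zero) = refl

liSum-opposite : ∀ a b γ α n → liSum a b γ (opposite α) n ≡ negOnePow n * liSum a b γ α n
liSum-opposite a b γ α n =
  trans (sumBelow-cong a (λ i → trans (cong (lambda (suc i) a b γ *_) (liCoeff-opposite (suc i) α n))
                                      (swap (lambda (suc i) a b γ) (negOnePow n) (liCoeff (suc i) α n))))
        (sym (*-distribˡ-sumBelow a (negOnePow n) _))
  where
  swap : ∀ x y z → x * (y * z) ≡ y * (x * z)
  swap = solve-∀ ℚ-ring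

rhsCoeff-opposite : ∀ a b α β n → rhsCoeff a b (opposite α) (opposite β) n ≡ negOnePow n * rhsCoeff a b α β n
rhsCoeff-opposite a b α β n = begin
  liSum a b (opposite α ⊖₂ opposite β) (opposite α) n + liSum b a (opposite β ⊖₂ opposite α) (opposite β) n
    + δ₂ (opposite α) (opposite β) * liCoeff (a ℕ.+ b) (opposite α) n
    ≡⟨ cong₂ _+_ (cong₂ _+_ (cong (λ γ → liSum a b γ (opposite α) n) (⊖₂-opposite α β))
                            (cong (λ γ → liSum b a γ (opposite β) n) (⊖₂-opposite β α)))
                 (cong₂ _*_ (δ₂-opposite α β) (liCoeff-opposite (a ℕ.+ b) α n)) ⟩
  liSum a b (α ⊖₂ β) (opposite α) n + liSum b a (β ⊖₂ α) (opposite β) n + δ₂ α β * (e * Z)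
    ≡⟨ cong₂ (λ x y → x + y + δ₂ α β * (e * Z)) (liSum-opposite a b (α ⊖₂ β) α n) (liSum-opposite b a (β ⊖₂ α) β n) ⟩
  e * liSum a b (α ⊖₂ β) α n + e * liSum b a (β ⊖₂ α) β n + δ₂ α β * (e * Z)
    ≡⟨ factor e (liSum a b (α ⊖₂ β) α n) (liSum b a (β ⊖₂ α) β n) (δ₂ α β) Z ⟩
  e * rhsCoeff a b α β n
    ∎
  where
  open ≡-Reasoning
  e = negOnePow n; Z = liCoeff (a ℕ.+ b) α n
  factor : ∀ e x y d z → e * x + e * y + d * (e * z) ≡ e * (x + y + d * z)
  factor = solve-∀ ℚ-ring

product-formula-opposite : ∀ {a b α β} n →
  (liCoeff a α ⋆ liCoeff b β) n ≡ rhsCoeff a b α β n →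
  (liCoeff a (opposite α) ⋆ liCoeff b (opposite β)) n ≡ rhsCoeff a b (opposite α) (opposite β) n
product-formula-opposite {a} {b} {α} {β} n formula = begin
  (liCoeff a (opposite α) ⋆ liCoeff b (opposite β)) n    ≡⟨ ⋆-cong (liCoeff-opposite a α) (liCoeff-opposite b β) n ⟩
  (alt (liCoeff a α) ⋆ alt (liCoeff b β)) n              ≡⟨ alt-⋆ (liCoeff a α) (liCoeff b β) n ⟨
  negOnePow n * (liCoeff a α ⋆ liCoeff b β) n            ≡⟨ cong (negOnePow n *_) formula ⟩
  negOnePow n * rhsCoeff a b α β n                       ≡⟨ rhsCoeff-opposite a b α β n ⟨
  rhsCoeff a b (opposite α) (opposite β) n               ∎
  where open ≡-Reasoning

product-formula-b≡1 : ∀ p α β n → (liCoeff (suc p) α ⋆ liCoeff 1 β) n ≡ rhsCoeff (suc p) 1 α β n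
product-formula-b≡1 p zero       β          n = product-formula-b≡1-α≡0 p β n
product-formula-b≡1 p (suc zero) zero       n = product-formula-opposite n (product-formula-b≡1-α≡0 p (suc zero) n)
product-formula-b≡1 p (suc zero) (suc zero) n = product-formula-opposite n (product-formula-b≡1-α≡0 p zero n)

product-formula : ∀ α β n a b → (liCoeff (suc a) α ⋆ liCoeff (suc b) β) n ≡ rhsCoeff (suc a) (suc b) α β n
product-formula α β n = θ-recurrence-unique (θ-recurrence-product α β n) (θ-recurrence-rhsCoeff α β n)
                                            (λ a → product-formula-b≡1 a α β n)

corollary5p4 : (a b : ℕ) → 1 ≤ a → 1 ≤ b → (α β : Fin 2) → (n : ℕ) →
    cauchy (liCoeff a α) (liCoeff b β) n ≡ rhsCoeff a b α β n
corollary5p4 (suc a) (suc b) _ _ α β n = product-formula α β n a b
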